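{- Let $m,n\geq 2$ be integers. For every integer $t$ with $4\leq t\leq \max\{3m+n+2,3n+m+2\}$, the torus $T(2m,2n)$ has an interval $t$-coloring. Let $m\geq 2$ and $n\geq 1$ be integers. If $m$ is odd, then for every integer $t$ with $4\leq t\leq 2m+2n+2$ the torus $T(2m,2n+1)$ has an interval $t$-coloring; if $m$ is even, then for every integer $t$ with $4\leq t\leq 2m+2n+3$ the torus $T(2m,2n+1)$ has an interval $t$-coloring.
   Context: All graphs are finite, undirected, without loops or multiple edges. An edge-coloring of a graph $G$ with colors $1,\ldots,t$ is an interval $t$-coloring if all $t$ colors are used, and the colors of the edges incident to each vertex are distinct and form an interval of consecutive integers. The torus $T(a,b)$ is the Cartesian product $C_a\square C_b$ of the cycles on $a$ and $b$ vertices, where $G\square H$ has vertex set $V(G)\times V(H)$, with $(u_1,v_1)(u_2,v_2)$ an edge iff either $u_1=u_2$ and $v_1v_2\in E(H)$, or $v_1=v_2$ and $u_1u_2\in E(G)$. -}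

module Defs where

open import Data.Nat using (ℕ; zero; suc; _+_; _*_; _≤_; _<_)
open import Data.Fin using (Fin; toℕ)
open import Data.Product using (Σ; ∃; ∃-syntax; _×_; _,_)
open import Data.Sum using (_⊎_)
open import Data.Empty using (⊥)
open import Relation.Nullary using (¬_)
open import Relation.Binary.PropositionalEquality using (_≡_)

-- "succ in C_a": j ≡ i + 1 (mod a), written without _%_:
cycleSucc : (a : ℕ) → Fin a → Fin a → Set
cycleSucc a i j = (toℕ j ≡ suc (toℕ i)) ⊎ (suc (toℕ i) ≡ a × toℕ j ≡ 0)

cycleAdj : (a : ℕ) → Fin a → Fin a → Set
cycleAdj a i j = cycleSucc a i j ⊎ cycleSucc a j i

-- Vertices of the torus T(a,b) = C_a □ C_b, encoded as Fin a × Fin b.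
-- (u1,v1) ~ (u2,v2) iff (u1 = u2 and v1 ~ v2 in C_b) or (v1 = v2 and u1 ~ u2 in C_a).
torusAdj : (a b : ℕ) →
           Fin a × Fin b → Fin a × Fin b → Set
torusAdj a b (u₁ , v₁) (u₂ , v₂) =
  (u₁ ≡ u₂ × cycleAdj b v₁ v₂) ⊎ (v₁ ≡ v₂ × cycleAdj a u₁ u₂)

-- Interval t-coloring of a graph given by a vertex type V and adjacency relation E
-- (E assumed symmetric).  An edge-coloring assigns to each edge xy (given as an
-- adjacency proof) a color, independent of orientation and of the proof.
record IntervalColoring {V : Set} (E : V → V → Set) (t : ℕ) : Set where
  field
    col        : (x y : V) → E x y → ℕ
    -- well-defined on undirected edges
    col-irrel  : ∀ {x y} (e e' : E x y) → col x y e ≡ col x y e'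
    col-sym    : ∀ {x y} (e : E x y) (e' : E y x) → col x y e ≡ col y x e'
    col-range  : ∀ {x y} (e : E x y) → 1 ≤ col x y e × col x y e ≤ t
    all-used   : ∀ k → 1 ≤ k → k ≤ t → ∃[ x ] ∃[ y ] Σ (E x y) λ e → col x y e ≡ k
    proper     : ∀ {x y z} (e : E x y) (e' : E x z) → col x y e ≡ col x z e' → y ≡ z
    interval   : ∀ {x y z} (e : E x y) (e' : E x z) k →
                 col x y e ≤ k → k ≤ col x z e' →
                 ∃[ w ] Σ (E x w) λ e'' → col x w e'' ≡ k

HasIntervalColoring : {V : Set} → (V → V → Set) → ℕ → Set
HasIntervalColoring E t = IntervalColoring E t

module Submission where

-- Every vertex of a torus has degree 4, so in an interval colouring its colours are
-- L, L+1, L+2, L+3 for some level L.  We build colourings from level certificates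
-- (LevelCert): edge colours and vertex levels such that the colours at every vertex
-- form such a window, all levels lie in [1, t-3] and both bounds are attained.
-- Neighbouring windows share a colour, so their levels differ by at most 3, and a
-- discrete intermediate value argument shows that every colour in [1, t] occurs
-- (torus-colouring).
--
-- All certificates are row-separable (RowData): vertical edges get C i + D j, and
-- row j carries a colouring of C_{2m} raised by d j, where the column profile D
-- steps by the row's spread.  Rows come from folding C_{2m} onto a path (Fold):
-- up to height p, back down, then oscillating.  Part A (even tori) uses a stair row
-- whose levels climb by 3 per step and a folded column profile; Part B (odd tori)
-- pulls three kinds of strips back along the fold and uses two column profiles on
-- C_{2n+1}.  Choosing heights and bases then realises every t in the stated ranges.

open import Defs
open import Data.Nat using (ℕ; zero; suc; _+_; _*_; _∸_; _≤_; _<_; _⊔_; z≤n; s≤s; _≤?_; _<?_; _≟_)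
open import Data.Nat.Properties
open import Data.Nat.DivMod using (_%_; _/_; [m+n]%n≡m%n; m%n<n; m≡m%n+[m/n]*n; m<n*o⇒m/o<n)
open import Data.Nat.Tactic.RingSolver using (solve-∀)
open import Data.Fin using (Fin; toℕ; fromℕ<)
import Data.Fin.Properties as Fin
open import Data.Product using (Σ; ∃-syntax; _×_; _,_; proj₁; proj₂)
open import Data.Sum using (_⊎_; inj₁; inj₂)
open import Data.Empty using (⊥; ⊥-elim)
open import Function using (_∘_)
open import Relation.Nullary using (¬_; yes; no)
open import Relation.Binary.Definitions using (tri<; tri≈; tri>)
open import Relation.Binary.PropositionalEquality

+-swapʳ : ∀ a b c → a + b + c ≡ a + c + b
+-swapʳ = solve-∀

data Dir : Set where
  left right down up : Dir

-- A colour (or offset) for each direction, listed in the order left, right, down, up.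
pick : ℕ → ℕ → ℕ → ℕ → Dir → ℕ
pick c₁ c₂ c₃ c₄ left  = c₁
pick c₁ c₂ c₃ c₄ right = c₂
pick c₁ c₂ c₃ c₄ down  = c₃
pick c₁ c₂ c₃ c₄ up    = c₄

-- A bijection from the four directions onto {0,1,2,3}: the offsets, above the
-- level of a vertex, of the colours of its four edges.
record Offsets (o : Dir → ℕ) : Set where
  field
    bounded   : ∀ d → o d ≤ 3
    injective : ∀ {d d'} → o d ≡ o d' → d ≡ d'
    covers    : ∀ k → k ≤ 3 → ∃[ d ] o d ≡ k

rank : Dir → ℕ
rank = pick 0 1 2 3

rank-offsets : Offsets rank
rank-offsets = record { bounded = bounded ; injective = injective ; covers = covers }
  where
  unrank : ℕ → Dir
  unrank 0 = left
  unrank 1 = right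
  unrank 2 = down
  unrank _ = up
  unrank-rank : ∀ d → unrank (rank d) ≡ d
  unrank-rank left  = refl
  unrank-rank right = refl
  unrank-rank down  = refl
  unrank-rank up    = refl
  bounded : ∀ d → rank d ≤ 3
  bounded left  = z≤n
  bounded right = s≤s z≤n
  bounded down  = s≤s (s≤s z≤n)
  bounded up    = ≤-refl
  injective : ∀ {d d'} → rank d ≡ rank d' → d ≡ d'
  injective {d} {d'} eq = trans (sym (unrank-rank d)) (trans (cong unrank eq) (unrank-rank d'))
  covers : ∀ k → k ≤ 3 → ∃[ d ] rank d ≡ k
  covers 0 _ = left , refl
  covers 1 _ = right , refl
  covers 2 _ = down , refl
  covers 3 _ = up , refl
  covers (suc (suc (suc (suc _)))) (s≤s (s≤s (s≤s ())))

relabel : ∀ {o} (σ : Dir → Dir) → (∀ d → σ (σ d) ≡ d) → Offsets o → Offsets (o ∘ σ)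
relabel {o} σ σσ P = record
  { bounded   = λ d → bounded (σ d)
  ; injective = λ {d} {d'} eq → trans (sym (σσ d)) (trans (cong σ (injective eq)) (σσ d'))
  ; covers    = λ k k≤3 → let (d , od≡k) = covers k k≤3 in σ d , trans (cong o (σσ d)) od≡k }
  where open Offsets P

swapLR swapRD swapDU swapAxes : Dir → Dir
swapLR left  = right
swapLR right = left
swapLR d     = d
swapRD right = down
swapRD down  = right
swapRD d     = d
swapDU down  = up
swapDU up    = down
swapDU d     = d
swapAxes left  = down
swapAxes right = up
swapAxes down  = left
swapAxes up    = right

swapLR² : ∀ d → swapLR (swapLR d) ≡ d
swapLR² left  = refl
swapLR² right = refl
swapLR² down  = refl
swapLR² up    = refl

swapRD² : ∀ d → swapRD (swapRD d) ≡ d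
swapRD² left  = refl
swapRD² right = refl
swapRD² down  = refl
swapRD² up    = refl

swapDU² : ∀ d → swapDU (swapDU d) ≡ d
swapDU² left  = refl
swapDU² right = refl
swapDU² down  = refl
swapDU² up    = refl

swapAxes² : ∀ d → swapAxes (swapAxes d) ≡ d
swapAxes² left  = refl
swapAxes² right = refl
swapAxes² down  = refl
swapAxes² up    = refl

-- The offset assignments used by the constructions; the digits list the offsets
-- of the left, right, down and up edge.
offsets0123 : Offsets (pick 0 1 2 3)
offsets0123 = rank-offsets

offsets1023 : Offsets (rank ∘ swapLR)
offsets1023 = relabel swapLR swapLR² rank-offsets

offsets0213 : Offsets (rank ∘ swapRD)
offsets0213 = relabel swapRD swapRD² rank-offsets

offsets2301 : Offsets (rank ∘ swapAxes)
offsets2301 = relabel swapAxes swapAxes² rank-offsets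

offsets0312 : Offsets (rank ∘ swapDU ∘ swapRD)
offsets0312 = relabel swapRD swapRD² (relabel swapDU swapDU² rank-offsets)

offsets3012 : Offsets (rank ∘ swapDU ∘ swapRD ∘ swapLR)
offsets3012 = relabel swapLR swapLR² offsets0312

offsets1302 : Offsets (rank ∘ swapLR ∘ swapDU ∘ swapRD)
offsets1302 = relabel swapRD swapRD² (relabel swapDU swapDU² offsets1023)

record Window (L c₁ c₂ c₃ c₄ : ℕ) : Set where
  constructor window
  field
    {offset} : Dir → ℕ
    offsets  : Offsets offset
    at-left  : c₁ ≡ L + offset left
    at-right : c₂ ≡ L + offset right
    at-down  : c₃ ≡ L + offset down
    at-up    : c₄ ≡ L + offset up

  colour-at : ∀ d → pick c₁ c₂ c₃ c₄ d ≡ L + offset d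
  colour-at left  = at-left
  colour-at right = at-right
  colour-at down  = at-down
  colour-at up    = at-up

  offset≤3 : ∀ d → offset d ≤ 3
  offset≤3 = Offsets.bounded offsets

window-resp : ∀ {L L' c₁ c₂ c₃ c₄ c₁' c₂' c₃' c₄'} →
              L ≡ L' → c₁ ≡ c₁' → c₂ ≡ c₂' → c₃ ≡ c₃' → c₄ ≡ c₄' →
              Window L' c₁' c₂' c₃' c₄' → Window L c₁ c₂ c₃ c₄
window-resp refl refl refl refl refl w = w

window-swapLR : ∀ {L c₁ c₂ c₃ c₄} → Window L c₁ c₂ c₃ c₄ → Window L c₂ c₁ c₃ c₄
window-swapLR (window P e₁ e₂ e₃ e₄) = window (relabel swapLR swapLR² P) e₂ e₁ e₃ e₄

window-swapDU : ∀ {L c₁ c₂ c₃ c₄} → Window L c₁ c₂ c₃ c₄ → Window L c₁ c₂ c₄ c₃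
window-swapDU (window P e₁ e₂ e₃ e₄) = window (relabel swapDU swapDU² P) e₁ e₂ e₄ e₃

window-transpose : ∀ {L c₁ c₂ c₃ c₄} → Window L c₁ c₂ c₃ c₄ → Window L c₃ c₄ c₁ c₂
window-transpose (window P e₁ e₂ e₃ e₄) = window (relabel swapAxes swapAxes² P) e₃ e₄ e₁ e₂

window-shift : ∀ {L c₁ c₂ c₃ c₄} s → Window L c₁ c₂ c₃ c₄ →
               Window (L + s) (c₁ + s) (c₂ + s) (c₃ + s) (c₄ + s)
window-shift {L} s (window {o} P e₁ e₂ e₃ e₄) =
  window P (shift e₁) (shift e₂) (shift e₃) (shift e₄)
  where
  shift : ∀ {c} {d} → c ≡ L + o d → c + s ≡ (L + s) + o d
  shift {c} {d} e = trans (cong (_+ s) e) (+-swapʳ L (o d) s)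

cpred : ℕ → ℕ → ℕ
cpred a zero    = a ∸ 1
cpred a (suc i) = i

cpred< : ∀ a i → i < a → cpred a i < a
cpred< (suc a) zero    _   = ≤-refl
cpred< a       (suc i) i<a = <-trans (n<1+n i) i<a

succ⇒cpred : ∀ {a} {i j : Fin a} → cycleSucc a i j → toℕ i ≡ cpred a (toℕ j)
succ⇒cpred (inj₁ j≡1+i) rewrite j≡1+i = refl
succ⇒cpred (inj₂ (1+i≡a , j≡0)) rewrite j≡0 = cong (_∸ 1) 1+i≡a

no-loop : ∀ {a} → 2 ≤ a → {i : Fin a} → cycleSucc a i i → ⊥
no-loop _ (inj₁ i≡1+i) = 1+n≢n (sym i≡1+i)
no-loop {a} 2≤a {i} (inj₂ (1+i≡a , i≡0)) = <-irrefl (trans (cong suc (sym i≡0)) 1+i≡a) 2≤a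

no-loop-adj : ∀ {a} → 2 ≤ a → (i : Fin a) → cycleAdj a i i → ⊥
no-loop-adj 2≤a i (inj₁ s) = no-loop 2≤a s
no-loop-adj 2≤a i (inj₂ s) = no-loop 2≤a s

no-2-cycle : ∀ {a} → 3 ≤ a → {i j : Fin a} → cycleSucc a i j → cycleSucc a j i → ⊥
no-2-cycle 3≤a {i} {j} (inj₁ e) (inj₁ e') = m≢1+n+m (toℕ i) {1} (trans e' (cong suc e))
no-2-cycle 3≤a {i} {j} (inj₁ e) (inj₂ (ea , e0)) with toℕ i | toℕ j
no-2-cycle 3≤a (inj₁ refl) (inj₂ (refl , refl)) | .0 | .1 = <-irrefl refl 3≤a
no-2-cycle 3≤a {i} {j} (inj₂ (ea , e0)) (inj₁ e) with toℕ i | toℕ j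
no-2-cycle 3≤a (inj₂ (refl , refl)) (inj₁ refl) | .1 | .0 = <-irrefl refl 3≤a
no-2-cycle 3≤a {i} {j} (inj₂ (ea , e0)) (inj₂ (ea' , e0')) with toℕ i | toℕ j
no-2-cycle 3≤a (inj₂ (refl , refl)) (inj₂ (ea' , refl)) | .0 | .0 = <-irrefl refl (≤-trans (s≤s (s≤s z≤n)) 3≤a)

next : ∀ a → 0 < a → Fin a → Fin a
next a 0<a i with suc (toℕ i) <? a
... | yes 1+i<a = fromℕ< 1+i<a
... | no _     = fromℕ< 0<a

next-succ : ∀ a (0<a : 0 < a) i → cycleSucc a i (next a 0<a i)
next-succ a 0<a i with suc (toℕ i) <? a
... | yes 1+i<a = inj₁ (Fin.toℕ-fromℕ< 1+i<a)
... | no  1+i≮a = inj₂ (≤∧≮⇒≡ (Fin.toℕ<n i) 1+i≮a , Fin.toℕ-fromℕ< 0<a)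

next-unique : ∀ a (0<a : 0 < a) i j → cycleSucc a i j → j ≡ next a 0<a i
next-unique a 0<a i j s with suc (toℕ i) <? a
next-unique a 0<a i j (inj₁ e) | yes 1+i<a = Fin.toℕ-injective (trans e (sym (Fin.toℕ-fromℕ< 1+i<a)))
next-unique a 0<a i j (inj₂ (e , _)) | yes 1+i<a = ⊥-elim (<-irrefl e 1+i<a)
next-unique a 0<a i j (inj₁ e) | no 1+i≮a = ⊥-elim (1+i≮a (subst (_< a) e (Fin.toℕ<n j)))
next-unique a 0<a i j (inj₂ (_ , e)) | no _ = Fin.toℕ-injective (trans e (sym (Fin.toℕ-fromℕ< 0<a)))

prev : ∀ a → 0 < a → Fin a → Fin a
prev a 0<a i = fromℕ< (cpred< a (toℕ i) (Fin.toℕ<n i))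

prev-succ : ∀ a (0<a : 0 < a) i → cycleSucc a (prev a 0<a i) i
prev-succ a 0<a i = by-value (toℕ i) refl (Fin.toℕ-fromℕ< _)
  where
  suc[a∸1] : ∀ a → 0 < a → suc (a ∸ 1) ≡ a
  suc[a∸1] (suc a) _ = refl
  by-value : ∀ n → toℕ i ≡ n → toℕ (prev a 0<a i) ≡ cpred a n → cycleSucc a (prev a 0<a i) i
  by-value zero    i≡0   p≡ = inj₂ (trans (cong suc p≡) (suc[a∸1] a 0<a) , i≡0)
  by-value (suc n) i≡1+n p≡ = inj₁ (trans i≡1+n (cong suc (sym p≡)))

prev-unique : ∀ a (0<a : 0 < a) i j → cycleSucc a j i → j ≡ prev a 0<a i
prev-unique a 0<a i j s = Fin.toℕ-injective (trans (succ⇒cpred s) (sym (Fin.toℕ-fromℕ< _)))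

ivt : (f : ℕ → ℕ) (N : ℕ) → (∀ s → s < N → f s ≤ f (suc s) + 3 × f (suc s) ≤ f s + 3) → ∀ c →
      (f 0 ≤ c × c ≤ f N + 3) ⊎ (f N ≤ c × c ≤ f 0 + 3) → ∃[ s ] (s ≤ N × f s ≤ c × c ≤ f s + 3)
ivt f zero _ c (inj₁ (p , q)) = 0 , z≤n , p , q
ivt f zero _ c (inj₂ (p , q)) = 0 , z≤n , p , q
ivt f (suc N) step c (inj₁ (p , q)) with c ≤? f 0 + 3
... | yes r = 0 , z≤n , p , r
... | no r with ivt (f ∘ suc) N (λ s s<N → step (suc s) (s≤s s<N)) c
                 (inj₁ (≤-trans (proj₂ (step 0 (s≤s z≤n))) (<⇒≤ (≰⇒> r)) , q))
...   | (s , s≤N , a₁ , a₂) = suc s , s≤s s≤N , a₁ , a₂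
ivt f (suc N) step c (inj₂ (p , q)) with f 0 ≤? c
... | yes r = 0 , z≤n , r , q
... | no r with ivt (f ∘ suc) N (λ s s<N → step (suc s) (s≤s s<N)) c
                 (inj₂ (p , ≤-trans (<⇒≤ (≰⇒> r)) (proj₁ (step 0 (s≤s z≤n)))))
...   | (s , s≤N , a₁ , a₂) = suc s , s≤s s≤N , a₁ , a₂

-- A level certificate for an interval t-colouring of T(a,b): hor i j colours the
-- edge (i,j)(i+1,j), ver i j the edge (i,j)(i,j+1), the colours at every vertex
-- form a window at its level, all levels lie in [1, t-3], and both ends are attained.
record LevelCert (a b t : ℕ) : Set where
  field
    hor ver level : ℕ → ℕ → ℕ
    window-at : ∀ i j → i < a → j < b →
                Window (level i j) (hor (cpred a i) j) (hor i j) (ver i (cpred b j)) (ver i j)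
    level≥1 : ∀ i j → i < a → j < b → 1 ≤ level i j
    level≤  : ∀ i j → i < a → j < b → level i j + 3 ≤ t
    i₀ j₀ i₁ j₁ : ℕ
    i₀<a : i₀ < a
    j₀<b : j₀ < b
    i₁<a : i₁ < a
    j₁<b : j₁ < b
    bottom : level i₀ j₀ ≡ 1
    top    : level i₁ j₁ + 3 ≡ t

transpose-cert : ∀ {a b t} → LevelCert b a t → LevelCert a b t
transpose-cert C = record
  { hor = λ i j → ver j i ; ver = λ i j → hor j i ; level = λ i j → level j i
  ; window-at = λ i j i< j< → window-transpose (window-at j i j< i<)
  ; level≥1 = λ i j i< j< → level≥1 j i j< i< ; level≤ = λ i j i< j< → level≤ j i j< i<
  ; i₀ = j₀ ; j₀ = i₀ ; i₁ = j₁ ; j₁ = i₁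
  ; i₀<a = j₀<b ; j₀<b = i₀<a ; i₁<a = j₁<b ; j₁<b = i₁<a ; bottom = bottom ; top = top }
  where open LevelCert C

module Colouring {a b t : ℕ} (3≤a : 3 ≤ a) (3≤b : 3 ≤ b) (C : LevelCert a b t) where
  open LevelCert C

  0<a : 0 < a
  0<a = ≤-trans (s≤s z≤n) 3≤a
  0<b : 0 < b
  0<b = ≤-trans (s≤s z≤n) 3≤b
  2≤a : 2 ≤ a
  2≤a = ≤-trans (s≤s (s≤s z≤n)) 3≤a

  V : Set
  V = Fin a × Fin b
  E : V → V → Set
  E = torusAdj a b

  window-of : (x : V) → Window (level (toℕ (proj₁ x)) (toℕ (proj₂ x))) _ _ _ _
  window-of (u , w) = window-at (toℕ u) (toℕ w) (Fin.toℕ<n u) (Fin.toℕ<n w)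

  lvl : V → ℕ
  lvl (u , w) = level (toℕ u) (toℕ w)

  offset : V → Dir → ℕ
  offset x = Window.offset (window-of x)

  colour : V → Dir → ℕ
  colour (u , w) = pick (hor (cpred a (toℕ u)) (toℕ w)) (hor (toℕ u) (toℕ w))
                        (ver (toℕ u) (cpred b (toℕ w))) (ver (toℕ u) (toℕ w))

  colour-level : ∀ x d → colour x d ≡ lvl x + offset x d
  colour-level x = Window.colour-at (window-of x)

  dir : ∀ {x y} → E x y → Dir
  dir (inj₁ (_ , inj₁ _)) = up
  dir (inj₁ (_ , inj₂ _)) = down
  dir (inj₂ (_ , inj₁ _)) = right
  dir (inj₂ (_ , inj₂ _)) = left

  nb : V → Dir → V
  nb (u , w) up    = u , next b 0<b w
  nb (u , w) down  = u , prev b 0<b w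
  nb (u , w) right = next a 0<a u , w
  nb (u , w) left  = prev a 0<a u , w

  nb-adj : ∀ x d → E x (nb x d)
  nb-adj (u , w) up    = inj₁ (refl , inj₁ (next-succ b 0<b w))
  nb-adj (u , w) down  = inj₁ (refl , inj₂ (prev-succ b 0<b w))
  nb-adj (u , w) right = inj₂ (refl , inj₁ (next-succ a 0<a u))
  nb-adj (u , w) left  = inj₂ (refl , inj₂ (prev-succ a 0<a u))

  dir-nb : ∀ x d → dir (nb-adj x d) ≡ d
  dir-nb x up    = refl
  dir-nb x down  = refl
  dir-nb x right = refl
  dir-nb x left  = refl

  nb-dir : ∀ x y (e : E x y) → y ≡ nb x (dir e)
  nb-dir (u , w) (.u , w') (inj₁ (refl , inj₁ s)) = cong (u ,_) (next-unique b 0<b w w' s)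
  nb-dir (u , w) (.u , w') (inj₁ (refl , inj₂ s)) = cong (u ,_) (prev-unique b 0<b w w' s)
  nb-dir (u , w) (u' , .w) (inj₂ (refl , inj₁ s)) = cong (_, w) (next-unique a 0<a u u' s)
  nb-dir (u , w) (u' , .w) (inj₂ (refl , inj₂ s)) = cong (_, w) (prev-unique a 0<a u u' s)

  col : (x y : V) → E x y → ℕ
  col (u , w) (u' , w') (inj₁ (_ , inj₁ _)) = ver (toℕ u) (toℕ w)
  col (u , w) (u' , w') (inj₁ (_ , inj₂ _)) = ver (toℕ u) (toℕ w')
  col (u , w) (u' , w') (inj₂ (_ , inj₁ _)) = hor (toℕ u) (toℕ w)
  col (u , w) (u' , w') (inj₂ (_ , inj₂ _)) = hor (toℕ u') (toℕ w)

  col-colour : ∀ x y (e : E x y) → col x y e ≡ colour x (dir e)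
  col-colour (u , w) (u' , w') (inj₁ (_ , inj₁ _)) = refl
  col-colour (u , w) (u' , w') (inj₁ (_ , inj₂ s)) = cong (ver (toℕ u)) (succ⇒cpred s)
  col-colour (u , w) (u' , w') (inj₂ (_ , inj₁ _)) = refl
  col-colour (u , w) (u' , w') (inj₂ (_ , inj₂ s)) = cong (λ z → hor z (toℕ w)) (succ⇒cpred s)

  col-level : ∀ x y (e : E x y) → col x y e ≡ lvl x + offset x (dir e)
  col-level x y e = trans (col-colour x y e) (colour-level x (dir e))

  -- The colour does not depend on the adjacency proof, nor on the end it is read
  -- from; on cycles of length ≥ 3 the two directions of an edge cannot coincide.
  col-irrel : ∀ {x y} (e e' : E x y) → col x y e ≡ col x y e'
  col-irrel (inj₁ (_ , inj₁ s)) (inj₁ (_ , inj₁ s')) = refl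
  col-irrel (inj₁ (_ , inj₁ s)) (inj₁ (_ , inj₂ s')) = ⊥-elim (no-2-cycle 3≤b s s')
  col-irrel (inj₁ (_ , inj₂ s)) (inj₁ (_ , inj₁ s')) = ⊥-elim (no-2-cycle 3≤b s s')
  col-irrel (inj₁ (_ , inj₂ s)) (inj₁ (_ , inj₂ s')) = refl
  col-irrel (inj₂ (_ , inj₁ s)) (inj₂ (_ , inj₁ s')) = refl
  col-irrel (inj₂ (_ , inj₁ s)) (inj₂ (_ , inj₂ s')) = ⊥-elim (no-2-cycle 3≤a s s')
  col-irrel (inj₂ (_ , inj₂ s)) (inj₂ (_ , inj₁ s')) = ⊥-elim (no-2-cycle 3≤a s s')
  col-irrel (inj₂ (_ , inj₂ s)) (inj₂ (_ , inj₂ s')) = refl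
  col-irrel {u , _} (inj₁ (refl , _)) (inj₂ (refl , s')) = ⊥-elim (no-loop-adj 2≤a u s')
  col-irrel {u , _} (inj₂ (refl , s)) (inj₁ (refl , _)) = ⊥-elim (no-loop-adj 2≤a u s)

  col-sym : ∀ {x y} (e : E x y) (e' : E y x) → col x y e ≡ col y x e'
  col-sym (inj₁ (_ , inj₁ s)) (inj₁ (_ , inj₁ s')) = ⊥-elim (no-2-cycle 3≤b s s')
  col-sym {u , w} (inj₁ (p , inj₁ _)) (inj₁ (_ , inj₂ _)) = cong (λ z → ver (toℕ z) (toℕ w)) p
  col-sym {_} {u' , w'} (inj₁ (p , inj₂ _)) (inj₁ (_ , inj₁ _)) = cong (λ z → ver (toℕ z) (toℕ w')) p
  col-sym (inj₁ (_ , inj₂ s)) (inj₁ (_ , inj₂ s')) = ⊥-elim (no-2-cycle 3≤b s s')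
  col-sym (inj₂ (_ , inj₁ s)) (inj₂ (_ , inj₁ s')) = ⊥-elim (no-2-cycle 3≤a s s')
  col-sym {u , w} (inj₂ (p , inj₁ _)) (inj₂ (_ , inj₂ _)) = cong (λ z → hor (toℕ u) (toℕ z)) p
  col-sym {_} {u' , w'} (inj₂ (p , inj₂ _)) (inj₂ (_ , inj₁ _)) = cong (λ z → hor (toℕ u') (toℕ z)) p
  col-sym (inj₂ (_ , inj₂ s)) (inj₂ (_ , inj₂ s')) = ⊥-elim (no-2-cycle 3≤a s s')
  col-sym {u , _} (inj₁ (refl , _)) (inj₂ (refl , s')) = ⊥-elim (no-loop-adj 2≤a u s')
  col-sym {u , _} (inj₂ (refl , s)) (inj₁ (refl , _)) = ⊥-elim (no-loop-adj 2≤a u s)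

  col-range : ∀ {x y} (e : E x y) → 1 ≤ col x y e × col x y e ≤ t
  col-range {x@(u , w)} {y} e rewrite col-level x y e =
    ≤-trans (level≥1 (toℕ u) (toℕ w) (Fin.toℕ<n u) (Fin.toℕ<n w)) (m≤m+n _ _) ,
    ≤-trans (+-monoʳ-≤ (lvl x) (Window.offset≤3 (window-of x) (dir e)))
            (level≤ (toℕ u) (toℕ w) (Fin.toℕ<n u) (Fin.toℕ<n w))

  proper : ∀ {x y z} (e : E x y) (e' : E x z) → col x y e ≡ col x z e' → y ≡ z
  proper {x} {y} {z} e e' eq =
    trans (nb-dir x y e) (trans (cong (nb x) same-dir) (sym (nb-dir x z e')))
    where
    same-offset : offset x (dir e) ≡ offset x (dir e')
    same-offset = +-cancelˡ-≡ (lvl x) _ _ (trans (sym (col-level x y e)) (trans eq (col-level x z e')))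
    same-dir : dir e ≡ dir e'
    same-dir = Offsets.injective (Window.offsets (window-of x)) same-offset

  hit : ∀ x k → lvl x ≤ k → k ≤ lvl x + 3 → ∃[ y ] Σ (E x y) λ e → col x y e ≡ k
  hit x k p q = nb x d , nb-adj x d , eq
    where
    covered : ∃[ d ] offset x d ≡ k ∸ lvl x
    covered = Offsets.covers (Window.offsets (window-of x)) (k ∸ lvl x) (m≤n+o⇒m∸n≤o k (lvl x) q)
    d : Dir
    d = proj₁ covered
    eq : col x (nb x d) (nb-adj x d) ≡ k
    eq = begin
      col x (nb x d) (nb-adj x d)         ≡⟨ col-level x _ (nb-adj x d) ⟩
      lvl x + offset x (dir (nb-adj x d)) ≡⟨ cong (λ z → lvl x + offset x z) (dir-nb x d) ⟩
      lvl x + offset x d                  ≡⟨ cong (lvl x +_) (proj₂ covered) ⟩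
      lvl x + (k ∸ lvl x)                 ≡⟨ m+[n∸m]≡n p ⟩
      k                                   ∎
      where open ≡-Reasoning

  interval : ∀ {x y z} (e : E x y) (e' : E x z) k →
             col x y e ≤ k → k ≤ col x z e' → ∃[ w ] Σ (E x w) λ e'' → col x w e'' ≡ k
  interval {x} {y} {z} e e' k p q =
    hit x k (≤-trans (m≤m+n _ _) (subst (_≤ k) (col-level x y e) p))
            (≤-trans (subst (k ≤_) (col-level x z e') q) (+-monoʳ-≤ (lvl x) (Window.offset≤3 (window-of x) (dir e'))))

  close : ∀ {c A B o o'} → c ≡ A + o → o ≤ 3 → c ≡ B + o' → o' ≤ 3 → A ≤ B + 3 × B ≤ A + 3
  close {c} {A} {B} {o} {o'} e₁ p₁ e₂ p₂ =
    ≤-trans (m≤m+n A o) (≤-trans (≤-reflexive (trans (sym e₁) e₂)) (+-monoʳ-≤ B p₂)) ,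
    ≤-trans (m≤m+n B o') (≤-trans (≤-reflexive (trans (sym e₂) e₁)) (+-monoʳ-≤ A p₁))

  row-step : ∀ i j → suc i < a → j < b → level i j ≤ level (suc i) j + 3 × level (suc i) j ≤ level i j + 3
  row-step i j 1+i<a j<b = close (Window.at-right w₁) (Window.offset≤3 w₁ right) (Window.at-left w₂) (Window.offset≤3 w₂ left)
    where
    w₁ : Window (level i j) (hor (cpred a i) j) (hor i j) (ver i (cpred b j)) (ver i j)
    w₁ = window-at i j (<-trans (n<1+n i) 1+i<a) j<b
    w₂ : Window (level (suc i) j) (hor i j) (hor (suc i) j) (ver (suc i) (cpred b j)) (ver (suc i) j)
    w₂ = window-at (suc i) j 1+i<a j<b

  column-step : ∀ i j → i < a → suc j < b → level i j ≤ level i (suc j) + 3 × level i (suc j) ≤ level i j + 3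
  column-step i j i<a 1+j<b = close (Window.at-up w₁) (Window.offset≤3 w₁ up) (Window.at-down w₂) (Window.offset≤3 w₂ down)
    where
    w₁ : Window (level i j) (hor (cpred a i) j) (hor i j) (ver i (cpred b j)) (ver i j)
    w₁ = window-at i j i<a (<-trans (n<1+n j) 1+j<b)
    w₂ : Window (level i (suc j)) (hor (cpred a i) (suc j)) (hor i (suc j)) (ver i j) (ver i (suc j))
    w₂ = window-at i (suc j) i<a 1+j<b

  Covered : ℕ → Set
  Covered c = Σ ℕ λ i → Σ ℕ λ j → i < a × j < b × level i j ≤ c × c ≤ level i j + 3

  along-row : ∀ i j → i < a → j < b → ∀ c →
              (level 0 j ≤ c × c ≤ level i j + 3) ⊎ (level i j ≤ c × c ≤ level 0 j + 3) → Covered c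
  along-row i j i<a j<b c between with ivt (λ s → level s j) i (λ s s<i → row-step s j (≤-<-trans s<i i<a) j<b) c between
  ... | (s , s≤i , p , q) = s , j , ≤-<-trans s≤i i<a , j<b , p , q

  along-column : ∀ i j → i < a → j < b → ∀ c →
                 (level i 0 ≤ c × c ≤ level i j + 3) ⊎ (level i j ≤ c × c ≤ level i 0 + 3) → Covered c
  along-column i j i<a j<b c between with ivt (level i) j (λ s s<j → column-step i s i<a (≤-<-trans s<j j<b)) c between
  ... | (s , s≤j , p , q) = i , s , i<a , ≤-<-trans s≤j j<b , p , q

  from-origin : ∀ i j → i < a → j < b → ∀ c →
                (level 0 0 ≤ c × c ≤ level i j + 3) ⊎ (level i j ≤ c × c ≤ level 0 0 + 3) → Covered c
  from-origin i j i<a j<b c (inj₁ (p , q)) with c ≤? level i 0 + 3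
  ... | yes r = along-row i 0 i<a 0<b c (inj₁ (p , r))
  ... | no r  = along-column i j i<a j<b c (inj₁ (≤-trans (m≤m+n _ 3) (<⇒≤ (≰⇒> r)) , q))
  from-origin i j i<a j<b c (inj₂ (p , q)) with level i 0 ≤? c
  ... | yes r = along-row i 0 i<a 0<b c (inj₂ (r , q))
  ... | no r  = along-column i j i<a j<b c (inj₂ (p , ≤-trans (<⇒≤ (≰⇒> r)) (m≤m+n _ 3)))

  coverage : ∀ c → 1 ≤ c → c ≤ t → Covered c
  coverage c 1≤c c≤t with c ≤? level 0 0 + 3
  ... | yes r = from-origin i₀ j₀ i₀<a j₀<b c (inj₂ (subst (_≤ c) (sym bottom) 1≤c , r))
  ... | no r  = from-origin i₁ j₁ i₁<a j₁<b c (inj₁ (≤-trans (m≤m+n _ 3) (<⇒≤ (≰⇒> r)) , subst (c ≤_) (sym top) c≤t))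

  all-used : ∀ k → 1 ≤ k → k ≤ t → ∃[ x ] ∃[ y ] Σ (E x y) λ e → col x y e ≡ k
  all-used k 1≤k k≤t with coverage k 1≤k k≤t
  ... | (i , j , i<a , j<b , p , q) = x , hit x k (subst (_≤ k) (sym level-x) p) (subst (k ≤_) (cong (_+ 3) (sym level-x)) q)
    where
    x : V
    x = fromℕ< i<a , fromℕ< j<b
    level-x : lvl x ≡ level i j
    level-x = cong₂ level (Fin.toℕ-fromℕ< i<a) (Fin.toℕ-fromℕ< j<b)

  colouring : IntervalColoring (torusAdj a b) t
  colouring = record
    { col = col ; col-irrel = col-irrel ; col-sym = col-sym ; col-range = col-range
    ; all-used = all-used ; proper = proper ; interval = interval }

torus-colouring : ∀ {a b t} → 3 ≤ a → 3 ≤ b → LevelCert a b t → HasIntervalColoring (torusAdj a b) t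
torus-colouring 3≤a 3≤b C = Colouring.colouring 3≤a 3≤b C

StepBy : ℕ → ℕ → ℕ → ℕ → Set
StepBy δ d x y = (x ≡ d × y ≡ d + δ) ⊎ (x ≡ d + δ × y ≡ d)

raise-by : ∀ {ℓ c₁ c₂ C δ} d → Window ℓ c₁ c₂ C (C + δ) → Window (ℓ + d) (c₁ + d) (c₂ + d) (C + d) (C + (d + δ))
raise-by {C = C} {δ} d w = window-resp refl refl refl refl (trans (sym (+-assoc C d δ)) (+-swapʳ C d δ)) (window-shift d w)

raise-window : ∀ {ℓ c₁ c₂ C δ d D₁ D₂} → Window ℓ c₁ c₂ C (C + δ) → StepBy δ d D₁ D₂ →
               Window (ℓ + d) (c₁ + d) (c₂ + d) (C + D₁) (C + D₂)
raise-window {d = d} w (inj₁ (refl , refl)) = raise-by d w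
raise-window {d = d} w (inj₂ (refl , refl)) = window-swapDU (raise-by d w)

-- Row j carries a colouring R j of the cycle C_a
-- together with vertical values C i, such that R j (i-1), R j i, C i, C i + δ j form
-- a window at level ℓ j i; along C_b the column profile D steps by δ j into row j,
-- with lower value d j.
record RowData (a b : ℕ) : Set where
  field
    D d δ : ℕ → ℕ
    R ℓ : ℕ → ℕ → ℕ
    C : ℕ → ℕ
    column-steps : ∀ j → j < b → StepBy (δ j) (d j) (D (cpred b j)) (D j)
    row-windows  : ∀ j i → j < b → i < a → Window (ℓ j i) (R j (cpred a i)) (R j i) (C i) (C i + δ j)

module RowCert {a b t : ℕ} (RD : RowData a b) where
  open RowData RD

  Level : ℕ → ℕ → ℕ
  Level i j = ℓ j i + d j

  cert : (∀ i j → i < a → j < b → 1 ≤ Level i j) → (∀ i j → i < a → j < b → Level i j + 3 ≤ t) →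
         (i₀ j₀ i₁ j₁ : ℕ) → i₀ < a → j₀ < b → i₁ < a → j₁ < b →
         Level i₀ j₀ ≡ 1 → Level i₁ j₁ + 3 ≡ t → LevelCert a b t
  cert lo hi i₀ j₀ i₁ j₁ i₀<a j₀<b i₁<a j₁<b bottom top = record
    { hor = λ i j → R j i + d j ; ver = λ i j → C i + D j ; level = Level
    ; window-at = λ i j i<a j<b → raise-window (row-windows j i j<b i<a) (column-steps j j<b)
    ; level≥1 = lo ; level≤ = hi ; i₀ = i₀ ; j₀ = j₀ ; i₁ = i₁ ; j₁ = j₁
    ; i₀<a = i₀<a ; j₀<b = j₀<b ; i₁<a = i₁<a ; j₁<b = j₁<b ; bottom = bottom ; top = top }

parity : ℕ → ℕ
parity zero          = 0
parity (suc zero)    = 1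
parity (suc (suc n)) = parity n

parity-step : ∀ n → StepBy 1 0 (parity n) (parity (suc n))
parity-step zero          = inj₁ (refl , refl)
parity-step (suc zero)    = inj₂ (refl , refl)
parity-step (suc (suc n)) = parity-step n

parity-odd : ∀ e → parity (suc (e + e)) ≡ 1
parity-odd zero = refl
parity-odd (suc e) rewrite +-suc e e = parity-odd e

parity-even : ∀ e → parity (e + e) ≡ 0
parity-even zero = refl
parity-even (suc e) rewrite +-suc e e = parity-even e

parity-double : ∀ e → parity (2 * e) ≡ 0
parity-double e = trans (cong (λ z → parity (e + z)) (+-identityʳ e)) (parity-even e)

parity-%2 : ∀ n → n % 2 ≡ parity n
parity-%2 zero          = refl
parity-%2 (suc zero)    = refl
parity-%2 (suc (suc n)) = trans (cong (_% 2) (+-comm 2 n)) (trans ([m+n]%n≡m%n n 2) (parity-%2 n))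

parity-stepBy : ∀ N x → N ≤ x → StepBy 1 0 (parity (x ∸ N)) (parity (suc x ∸ N))
parity-stepBy N x N≤x rewrite +-∸-assoc 1 N≤x = parity-step (x ∸ N)

∸-step : ∀ N x → suc x ≤ N → N ∸ x ≡ suc (N ∸ suc x)
∸-step (suc N) zero    _       = refl
∸-step (suc N) (suc x) (s≤s p) = ∸-step N x p

piecewise : ℕ → ℕ → (ℕ → ℕ) → (ℕ → ℕ) → (ℕ → ℕ) → ℕ → ℕ
piecewise A B f g h x with x ≤? A
... | yes _ = f x
... | no _ with x ≤? B
...   | yes _ = g x
...   | no _ = h x

module _ {A B : ℕ} {f g h : ℕ → ℕ} where
  piece₁ : ∀ {x} → x ≤ A → piecewise A B f g h x ≡ f x
  piece₁ {x} x≤A with x ≤? A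
  ... | yes _ = refl
  ... | no x≰A = ⊥-elim (x≰A x≤A)

  piece₂ : ∀ {x} → A < x → x ≤ B → piecewise A B f g h x ≡ g x
  piece₂ {x} A<x x≤B with x ≤? A
  ... | yes x≤A = ⊥-elim (<⇒≱ A<x x≤A)
  ... | no _ with x ≤? B
  ...   | yes _ = refl
  ...   | no x≰B = ⊥-elim (x≰B x≤B)

  piece₃ : ∀ {x} → A ≤ B → B < x → piecewise A B f g h x ≡ h x
  piece₃ {x} A≤B B<x with x ≤? A
  ... | yes x≤A = ⊥-elim (<⇒≱ B<x (≤-trans x≤A A≤B))
  ... | no _ with x ≤? B
  ...   | yes x≤B = ⊥-elim (<⇒≱ B<x x≤B)
  ...   | no _ = refl

-- Folding the cycle C_{2m} onto a path with edges 0, 1, …, p, where p = q + 1 ≤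
-- m = k + 2: in order, the edges of the cycle run through the path edges 0, 1, …, p,
-- back down to 0, and then alternate between 0 and 1.  Cycle edge x (from vertex x
-- to x + 1) goes to path edge fold x; the two edges at cycle vertex x go to the path
-- edges foot x and foot x + 1, which meet in path vertex apex x (up to identifying
-- the path vertices 0 and 1 at the turning points).
module Fold (k q : ℕ) where
  m p P2 : ℕ
  m  = suc (suc k)
  p  = suc q
  P2 = 2 * p

  p<P2 : p < P2
  p<P2 = subst (p <_) (sym (+-suc p (q + 0))) (s≤s (m≤m+n p _))

  p≤P2 : p ≤ P2
  p≤P2 = <⇒≤ p<P2

  P2∸p : P2 ∸ p ≡ p
  P2∸p = trans (cong (λ z → p + z ∸ p) (+-identityʳ p)) (m+n∸m≡n p p)

  P2∸[1+p] : P2 ∸ suc p ≡ q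
  P2∸[1+p] = trans (cong (_∸ suc p) (+-suc p (q + 0))) (trans (cong (λ z → suc p + z ∸ suc p) (+-identityʳ q)) (m+n∸m≡n (suc p) q))

  fold : ℕ → ℕ
  fold = piecewise p P2 (λ x → x) (P2 ∸_) (λ x → parity (x ∸ P2))

  foot : ℕ → ℕ
  foot zero    = 0
  foot (suc x) = piecewise p P2 (λ _ → x) (λ _ → P2 ∸ suc x) (λ _ → 0) (suc x)

  apex : ℕ → ℕ
  apex zero    = 0
  apex (suc x) = piecewise p (suc P2) (λ _ → suc x) (λ _ → P2 ∸ x) (λ _ → 0) (suc x)

  data Phase : ℕ → Set where
    start       : Phase 0
    ascent      : ∀ x → suc x ≤ p → Phase (suc x)
    descent     : ∀ x → p < suc x → suc x ≤ P2 → Phase (suc x)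
    return      : Phase (suc P2)
    oscillation : ∀ x → suc P2 < suc x → Phase (suc x)

  phase : ∀ x → Phase x
  phase zero = start
  phase (suc x) with suc x ≤? p
  ... | yes h = ascent x h
  ... | no h with suc x ≤? P2
  ...   | yes h' = descent x (≰⇒> h) h'
  ...   | no h' with <-cmp x P2
  ...     | tri≈ _ refl _ = return
  ...     | tri< lt _ _ = ⊥-elim (h' lt)
  ...     | tri> _ _ gt = oscillation x (s≤s gt)

  fold-up : ∀ x → x ≤ p → fold x ≡ x
  fold-up x = piece₁

  fold-osc : ∀ x → P2 < x → fold x ≡ parity (x ∸ P2)
  fold-osc x = piece₃ p≤P2

  foot-ascent : ∀ x → suc x ≤ p → foot (suc x) ≡ x
  foot-ascent x = piece₁

  foot-descent : ∀ x → p < suc x → suc x ≤ P2 → foot (suc x) ≡ P2 ∸ suc x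
  foot-descent x = piece₂

  foot-osc : ∀ x → P2 < suc x → foot (suc x) ≡ 0
  foot-osc x = piece₃ p≤P2

  apex-ascent : ∀ x → suc x ≤ p → apex (suc x) ≡ suc x
  apex-ascent x = piece₁

  apex-descent : ∀ x → p < suc x → suc x ≤ suc P2 → apex (suc x) ≡ P2 ∸ x
  apex-descent x = piece₂

  apex-osc : ∀ x → suc P2 < suc x → apex (suc x) ≡ 0
  apex-osc x = piece₃ (≤-trans p≤P2 (n≤1+n P2))

  fold-down : ∀ x → p ≤ x → x ≤ P2 → fold x ≡ P2 ∸ x
  fold-down x p≤x x≤P2 with m≤n⇒m<n∨m≡n p≤x
  ... | inj₁ p<x = piece₂ p<x x≤P2
  ... | inj₂ refl = trans (fold-up p ≤-refl) (sym P2∸p)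

  -- The last edge 2m-1 of the cycle: if p = m it ends the descent, and otherwise it
  -- ends the oscillation after an odd number of steps; either way it folds to 1.
  last-descends : q ≡ suc k → p < 2 * m ∸ 1 × 2 * m ∸ 1 ≤ P2
  last-descends refl = s≤s (≤-trans (≤-reflexive (cong (suc ∘ suc) (sym (+-identityʳ k)))) (m≤n+m _ k)) , n≤1+n _

  last-oscillates : q ≤ k → P2 < 2 * m ∸ 1
  last-oscillates q≤k = s≤s (≤-trans (*-monoʳ-≤ 2 (s≤s q≤k)) (≤-reflexive (double k)))
    where
    double : ∀ k → 2 * suc k ≡ k + suc (suc (k + 0))
    double = solve-∀

  fold-last : p ≤ m → fold (2 * m ∸ 1) ≡ 1
  fold-last p≤m with m≤n⇒m<n∨m≡n p≤m
  ... | inj₂ p≡m = ends-descent (suc-injective p≡m)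
    where
    ends-descent : q ≡ suc k → fold (2 * m ∸ 1) ≡ 1
    ends-descent q≡1+k@refl =
      let (p<l , l≤P2) = last-descends q≡1+k in trans (piece₂ p<l l≤P2) (m+n∸n≡m 1 (k + suc (suc (k + 0))))
  ... | inj₁ p<m = trans (fold-osc _ (last-oscillates q≤k)) (subst (λ k' → parity (2 * suc (suc k') ∸ 1 ∸ P2) ≡ 1) k≡q+e odd-tail)
    where
    q≤k : q ≤ k
    q≤k = ≤-pred (≤-pred p<m)
    e : ℕ
    e = k ∸ q
    k≡q+e : q + e ≡ k
    k≡q+e = m+[n∸m]≡n q≤k
    length : ∀ q e → 2 * suc (suc (q + e)) ∸ 1 ≡ 2 * suc q + suc (e + e)
    length q e = trans (cong (_∸ 1) (expand q e)) (m+n∸m≡n 1 (2 * suc q + suc (e + e)))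
      where
      expand : ∀ q e → 2 * suc (suc (q + e)) ≡ 1 + (2 * suc q + suc (e + e))
      expand = solve-∀
    odd-tail : parity (2 * suc (suc (q + e)) ∸ 1 ∸ P2) ≡ 1
    odd-tail = trans (cong (λ z → parity (z ∸ P2)) (length q e)) (trans (cong parity (m+n∸m≡n P2 (suc (e + e)))) (parity-odd e))

  fold-step : p ≤ m → ∀ x → StepBy 1 (foot x) (fold (cpred (2 * m) x)) (fold x)
  fold-step p≤m x with phase x
  ... | start = inj₂ (fold-last p≤m , fold-up 0 z≤n)
  ... | ascent x h rewrite foot-ascent x h =
    inj₁ (fold-up x (≤-trans (n≤1+n x) h) , trans (fold-up (suc x) h) (+-comm 1 x))
  ... | descent x h₁ h₂ rewrite foot-descent x h₁ h₂ =
    inj₂ (trans (fold-down x (≤-pred h₁) (≤-trans (n≤1+n _) h₂)) (trans (∸-step P2 x h₂) (+-comm 1 _)) ,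
          fold-down (suc x) (<⇒≤ h₁) h₂)
  ... | return rewrite foot-osc P2 (n<1+n P2) =
    inj₁ (trans (fold-down P2 (<⇒≤ p<P2) ≤-refl) (n∸n≡0 P2) ,
          trans (fold-osc (suc P2) (n<1+n P2)) (cong parity (m+n∸n≡m 1 P2)))
  ... | oscillation x h rewrite foot-osc x (<-trans (n<1+n P2) h)
                              | fold-osc x (≤-pred h) | fold-osc (suc x) (<-trans (n<1+n P2) h) =
    parity-stepBy P2 x (<⇒≤ (≤-pred h))

  apex-foot : ∀ x → apex x ≡ suc (foot x) ⊎ (apex x ≡ 0 × foot x ≡ 0)
  apex-foot x with phase x
  ... | start = inj₂ (refl , refl)
  ... | ascent x h = inj₁ (trans (apex-ascent x h) (cong suc (sym (foot-ascent x h))))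
  ... | descent x h₁ h₂ =
    inj₁ (trans (apex-descent x h₁ (≤-trans h₂ (n≤1+n _))) (trans (∸-step P2 x h₂) (cong suc (sym (foot-descent x h₁ h₂)))))
  ... | return = inj₂ (trans (apex-descent P2 (<-trans p<P2 (n<1+n _)) ≤-refl) (n∸n≡0 P2) , foot-osc P2 (n<1+n P2))
  ... | oscillation x h = inj₂ (apex-osc x h , foot-osc x (<-trans (n<1+n P2) h))

  foot≤q : ∀ x → foot x ≤ q
  foot≤q x with phase x
  ... | start = z≤n
  ... | ascent x h = subst (_≤ q) (sym (foot-ascent x h)) (≤-pred h)
  ... | descent x h₁ h₂ = subst (_≤ q) (sym (foot-descent x h₁ h₂)) (≤-trans (∸-monoʳ-≤ P2 h₁) (≤-reflexive P2∸[1+p]))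
  ... | return = subst (_≤ q) (sym (foot-osc P2 (n<1+n P2))) z≤n
  ... | oscillation x h = subst (_≤ q) (sym (foot-osc x (<-trans (n<1+n P2) h))) z≤n

  foot-peak : foot p ≡ q
  foot-peak = foot-ascent q ≤-refl

  -- Vertical values g with g 0 ≡ g 1 cannot tell apex x from foot x + 1.
  g-apex : (g : ℕ → ℕ) → g 0 ≡ g 1 → ∀ x → g (apex x) ≡ g (suc (foot x))
  g-apex g g₀ x with apex-foot x
  ... | inj₁ e = cong g e
  ... | inj₂ (a≡0 , f≡0) = trans (cong g a≡0) (trans g₀ (cong (g ∘ suc) (sym f≡0)))

  -- A strip on the path consists of edge
  -- colours f, vertical values g with g 0 ≡ g 1, and levels l such that the edges
  -- j and j + 1 together with g (j+1), g (j+1) + δ form a window at level l j; the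
  -- pulled-back row colouring of C_{2m} then has a window at every vertex.
  pullback : (f g l : ℕ → ℕ) (δ : ℕ) →
             (∀ j → Window (l j) (f j) (f (suc j)) (g (suc j)) (g (suc j) + δ)) → g 0 ≡ g 1 → p ≤ m →
             ∀ x → Window (l (foot x)) (f (fold (cpred (2 * m) x))) (f (fold x)) (g (apex x)) (g (apex x) + δ)
  pullback f g l δ strip g₀ p≤m x with fold-step p≤m x
  ... | inj₁ (e₁ , e₂) =
    window-resp refl (cong f e₁) (cong f (trans e₂ (+-comm _ 1))) (g-apex g g₀ x) (cong (_+ δ) (g-apex g g₀ x))
                (strip (foot x))
  ... | inj₂ (e₁ , e₂) =
    window-resp refl (cong f (trans e₁ (+-comm _ 1))) (cong f e₂) (g-apex g g₀ x) (cong (_+ δ) (g-apex g g₀ x))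
                (window-swapLR (strip (foot x)))

-- The stair row on C_{2m}, with base level β and stair height p = q + 1 ≤ m:
-- going up, edge j + 1 gets colour β + 3j + 1, so the levels rise by 3 per step;
-- coming down edge x gets β + 3 (2p - x); after the return to the bottom the row
-- oscillates between β and β + 1.  The window at vertex 1 is supplied from outside.
module StairRow (k q β g₁ : ℕ) where
  open Fold k q

  edge : ℕ → ℕ
  edge zero    = β
  edge (suc x) = piecewise p P2 (λ _ → β + 3 * x + 1) (λ y → β + 3 * (P2 ∸ y)) (λ y → β + parity (y ∸ P2)) (suc x)

  vert : ℕ → ℕ
  vert zero with p ≟ m
  ... | yes _ = β + 1
  ... | no _  = β + 2
  vert (suc zero)    = g₁
  vert (suc (suc y)) = piecewise (suc p) P2 (λ _ → β + 3 * y + 2) (λ x → β + 3 * (P2 ∸ x) + 1) (λ _ → β + 2) (suc (suc y))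

  lev : ℕ → ℕ
  lev zero          = β
  lev (suc zero)    = 1
  lev (suc (suc y)) = piecewise p P2 (λ _ → β + 3 * y + 1) (λ x → β + 3 * (P2 ∸ x)) (λ _ → β) (suc (suc y))

  data Spot : ℕ → Set where
    origin  : Spot 0
    first   : Spot 1
    climb   : ∀ y → suc (suc y) ≤ p → Spot (suc (suc y))
    summit  : Spot (suc p)
    descend : ∀ y → suc p < suc (suc y) → suc (suc y) ≤ P2 → Spot (suc (suc y))
    swing   : ∀ y → P2 < suc (suc y) → Spot (suc (suc y))

  spot : ∀ x → Spot x
  spot zero = origin
  spot (suc zero) = first
  spot (suc (suc y)) with suc (suc y) ≤? p
  ... | yes h = climb y h
  ... | no h with suc y ≟ p
  ...   | yes refl = summit
  ...   | no h' with suc (suc y) ≤? P2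
  ...     | yes h'' = descend y (s≤s (≤∧≢⇒< (≤-pred (≰⇒> h)) (λ e → h' (sym e)))) h''
  ...     | no h'' = swing y (≰⇒> h'')

  edge-climb : ∀ x → suc x ≤ p → edge (suc x) ≡ β + 3 * x + 1
  edge-climb x = piece₁

  edge-descend : ∀ x → p < suc x → suc x ≤ P2 → edge (suc x) ≡ β + 3 * (P2 ∸ suc x)
  edge-descend x = piece₂

  vert-climb : ∀ y → suc (suc y) ≤ suc p → vert (suc (suc y)) ≡ β + 3 * y + 2
  vert-climb y = piece₁

  vert-descend : ∀ y → suc p < suc (suc y) → suc (suc y) ≤ P2 → vert (suc (suc y)) ≡ β + 3 * (P2 ∸ suc (suc y)) + 1
  vert-descend y = piece₂

  vert-swing : ∀ y → P2 < suc (suc y) → vert (suc (suc y)) ≡ β + 2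
  vert-swing y = piece₃ p<P2

  lev-climb : ∀ y → suc (suc y) ≤ p → lev (suc (suc y)) ≡ β + 3 * y + 1
  lev-climb y = piece₁

  lev-descend : ∀ y → p < suc (suc y) → suc (suc y) ≤ P2 → lev (suc (suc y)) ≡ β + 3 * (P2 ∸ suc (suc y))
  lev-descend y = piece₂

  lev-swing : ∀ y → P2 < suc (suc y) → lev (suc (suc y)) ≡ β
  lev-swing y = piece₃ p≤P2

  edge-swing : ∀ x → P2 < suc x → edge (suc x) ≡ β + parity (suc x ∸ P2)
  edge-swing x = piece₃ p≤P2

  edge-tail : ∀ x → P2 ≤ x → edge x ≡ β + fold x
  edge-tail x P2≤x with m≤n⇒m<n∨m≡n P2≤x
  edge-tail (suc x) _ | inj₁ P2<x = trans (edge-swing x P2<x) (cong (β +_) (sym (fold-osc (suc x) P2<x)))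
  edge-tail x _ | inj₂ P2≡x = subst (λ z → edge z ≡ β + fold z) P2≡x edge-return
    where
    edge-return : edge P2 ≡ β + fold P2
    edge-return = trans (edge-descend (q + suc (q + 0)) p<P2 ≤-refl)
      (cong (β +_) (trans (cong (3 *_) (n∸n≡0 P2)) (sym (trans (fold-down P2 p≤P2 ≤-refl) (n∸n≡0 P2)))))

  edge-last-descent : q ≡ suc k → edge (2 * m ∸ 1) ≡ β + 3
  edge-last-descent q≡1+k@refl = let (p<l , l≤P2) = last-descends q≡1+k in
    trans (edge-descend _ p<l l≤P2) (cong (λ z → β + 3 * z) (trans (sym (fold-down _ (<⇒≤ p<l) l≤P2)) (fold-last ≤-refl)))

  edge-last-swing : q ≤ k → edge (2 * m ∸ 1) ≡ β + 1
  edge-last-swing q≤k = trans (edge-tail _ (<⇒≤ (last-oscillates q≤k))) (cong (β +_) (fold-last (s≤s (≤-trans q≤k (n≤1+n k)))))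

  vert-origin-descent : p ≡ m → vert 0 ≡ β + 1
  vert-origin-descent p≡m with p ≟ m
  ... | yes _ = refl
  ... | no p≢m = ⊥-elim (p≢m p≡m)

  vert-origin-swing : ¬ p ≡ m → vert 0 ≡ β + 2
  vert-origin-swing p≢m with p ≟ m
  ... | yes p≡m = ⊥-elim (p≢m p≡m)
  ... | no _ = refl

  origin-window : p ≤ m → Window (lev 0) (edge (2 * m ∸ 1)) (edge 0) (vert 0) (vert 0 + 1)
  origin-window p≤m with m≤n⇒m<n∨m≡n p≤m
  ... | inj₂ p≡m = window-resp refl (edge-last-descent (suc-injective p≡m)) refl
                     (vert-origin-descent p≡m) (cong (_+ 1) (vert-origin-descent p≡m))
                     (window offsets3012 refl (sym (+-identityʳ β)) refl (+-assoc β 1 1))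
  ... | inj₁ p<m = window-resp refl (edge-last-swing (≤-pred (≤-pred p<m))) refl
                     (vert-origin-swing (<⇒≢ p<m)) (cong (_+ 1) (vert-origin-swing (<⇒≢ p<m)))
                     (window offsets1023 refl (sym (+-identityʳ β)) refl (+-assoc β 2 1))

  swing-window : p ≤ m → ∀ y → P2 < suc (suc y) →
                 Window (lev (suc (suc y))) (edge (suc y)) (edge (suc (suc y))) (vert (suc (suc y))) (vert (suc (suc y)) + 1)
  swing-window p≤m y h with fold-step p≤m (suc (suc y))
  ... | inj₁ (e₁ , e₂) =
    window-resp (lev-swing y h) (trans (edge-tail _ (≤-pred h)) (cong (β +_) (trans e₁ (foot-osc (suc y) h))))
                (trans (edge-tail _ (<⇒≤ h)) (cong (β +_) (trans e₂ (cong (_+ 1) (foot-osc (suc y) h)))))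
                (vert-swing y h) (cong (_+ 1) (vert-swing y h))
      (window offsets0123 refl refl refl (+-assoc β 2 1))
  ... | inj₂ (e₁ , e₂) =
    window-resp (lev-swing y h) (trans (edge-tail _ (≤-pred h)) (cong (β +_) (trans e₁ (cong (_+ 1) (foot-osc (suc y) h)))))
                (trans (edge-tail _ (<⇒≤ h)) (cong (β +_) (trans e₂ (foot-osc (suc y) h))))
                (vert-swing y h) (cong (_+ 1) (vert-swing y h))
      (window offsets1023 refl refl refl (+-assoc β 2 1))

  -- On
  -- the way up the edges are L and L + 3 around vertical values L + 1, L + 2, at the
  -- summit L + 1 and L, and on the way down L + 3 and L.
  stair-window : p ≤ m → Window 1 β (β + 1) g₁ (g₁ + 1) →
                 ∀ x → Window (lev x) (edge (cpred (2 * m) x)) (edge x) (vert x) (vert x + 1)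
  stair-window p≤m w₁ x with spot x
  ... | origin = origin-window p≤m
  ... | first = window-resp refl refl (trans (edge-climb 0 (s≤s z≤n)) (cong (_+ 1) (+-identityʳ β))) refl refl w₁
  stair-window p≤m w₁ x | climb y h =
    window-resp (lev-climb y h) (edge-climb y (≤-trans (n≤1+n _) h)) (edge-climb (suc y) h)
                (vert-climb y (≤-trans h (n≤1+n p))) (cong (_+ 1) (vert-climb y (≤-trans h (n≤1+n p))))
      (window offsets0312 (sym (+-identityʳ _)) (up-step β y) (vert-step β y) (vert-step' β y))
    where
    up-step : ∀ β y → β + 3 * suc y + 1 ≡ β + 3 * y + 1 + 3
    up-step = solve-∀
    vert-step : ∀ β y → β + 3 * y + 2 ≡ β + 3 * y + 1 + 1
    vert-step = solve-∀
    vert-step' : ∀ β y → β + 3 * y + 2 + 1 ≡ β + 3 * y + 1 + 2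
    vert-step' = solve-∀
  stair-window p≤m w₁ x | summit =
    window-resp (trans (lev-descend q (n<1+n p) p<P2) (cong (λ z → β + 3 * z) P2∸[1+p])) (edge-climb q ≤-refl)
                (trans (edge-descend p (n<1+n p) p<P2) (cong (λ z → β + 3 * z) P2∸[1+p]))
                (vert-climb q ≤-refl) (cong (_+ 1) (vert-climb q ≤-refl))
      (window offsets1023 refl (sym (+-identityʳ _)) refl (+-assoc _ 2 1))
  stair-window p≤m w₁ x | descend y h₁ h₂ =
    window-resp (lev-descend y (<-trans (n<1+n p) h₁) h₂) (edge-descend y (≤-pred h₁) (≤-trans (n≤1+n _) h₂))
                (edge-descend (suc y) (<-trans (n<1+n p) h₁) h₂) (vert-descend y h₁ h₂) (cong (_+ 1) (vert-descend y h₁ h₂))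
      (window offsets3012 (trans (cong (λ z → β + 3 * z) (∸-step P2 (suc y) h₂)) (down-step β _)) (sym (+-identityʳ _)) refl (+-assoc _ 1 1))
    where
    down-step : ∀ β w → β + 3 * suc w ≡ β + 3 * w + 3
    down-step = solve-∀
  stair-window p≤m w₁ x | swing y h = swing-window p≤m y h

  lev-summit : lev (suc p) ≡ β + 3 * q
  lev-summit = trans (lev-descend q (n<1+n p) p<P2) (cong (λ z → β + 3 * z) P2∸[1+p])

  lev-bounds : ∀ x → lev x ≡ 1 ⊎ (β ≤ lev x × lev x ≤ β + 3 * q)
  lev-bounds x with spot x
  ... | origin = inj₂ (≤-refl , m≤m+n β _)
  ... | first = inj₁ refl
  ... | climb y h = inj₂ (subst (β ≤_) (sym (lev-climb y h)) (≤-trans (m≤m+n β _) (m≤m+n _ 1)) ,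
                          subst (_≤ β + 3 * q) (sym (lev-climb y h)) (climb-bound (≤-pred h)))
    where
    climb-bound : suc y ≤ q → β + 3 * y + 1 ≤ β + 3 * q
    climb-bound y<q = ≤-trans (≤-trans (m≤m+n _ 2) (≤-reflexive (next-stair β y))) (+-monoʳ-≤ β (*-monoʳ-≤ 3 y<q))
      where
      next-stair : ∀ β y → β + 3 * y + 1 + 2 ≡ β + 3 * suc y
      next-stair = solve-∀
  ... | summit = inj₂ (subst (β ≤_) (sym lev-summit) (m≤m+n β _) , ≤-reflexive lev-summit)
  ... | descend y h₁ h₂ = inj₂ (subst (β ≤_) (sym lev-y) (m≤m+n β _) ,
                                subst (_≤ β + 3 * q) (sym lev-y)
                                  (+-monoʳ-≤ β (*-monoʳ-≤ 3 (≤-trans (∸-monoʳ-≤ P2 (<⇒≤ h₁)) (≤-reflexive P2∸[1+p])))))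
    where
    lev-y : lev (suc (suc y)) ≡ β + 3 * (P2 ∸ suc (suc y))
    lev-y = lev-descend y (<-trans (n<1+n p) h₁) h₂
  ... | swing y h = inj₂ (≤-reflexive (sym (lev-swing y h)) , subst (_≤ β + 3 * q) (sym (lev-swing y h)) (m≤m+n β _))


-- The Part A certificate for T(2m, 2n): every row carries the stair row with base β
-- and height q + 1, lifted by the fold of C_{2n} onto a path of length r = r' + 1.
-- The level 1 sits at vertex (1, 0) and the top level β + 3q + r - 1 at the summit
-- of column r.
stair-cert : ∀ k q n' r' β g₁ → q ≤ suc k → suc r' ≤ suc (suc n') → 1 ≤ β →
             Window 1 β (β + 1) g₁ (g₁ + 1) →
             LevelCert (2 * suc (suc k)) (2 * suc (suc n')) (β + 3 * q + suc r' + 2)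
stair-cert k q n' r' β g₁ q≤1+k r≤n 1≤β w₁ =
  RowCert.cert rows level≥1 level≤ 1 0 (suc (suc q)) (suc r') 1<2m (s≤s z≤n) summit<2m r<2n refl top
  where
  open StairRow k q β g₁
  module Column = Fold n' r'
  rows : RowData (2 * suc (suc k)) (2 * suc (suc n'))
  rows = record { D = Column.fold ; d = Column.foot ; δ = λ _ → 1 ; R = λ _ → edge ; C = vert ; ℓ = λ _ → lev
                ; column-steps = λ j _ → Column.fold-step r≤n j
                ; row-windows = λ j i _ _ → stair-window (s≤s q≤1+k) w₁ i }
  level≥1 : ∀ i j → i < 2 * suc (suc k) → j < 2 * suc (suc n') → 1 ≤ lev i + Column.foot j
  level≥1 i j _ _ with lev-bounds i
  ... | inj₁ e = ≤-trans (≤-reflexive (sym e)) (m≤m+n _ _)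
  ... | inj₂ (β≤ , _) = ≤-trans (≤-trans 1≤β β≤) (m≤m+n _ _)
  level≤ : ∀ i j → i < 2 * suc (suc k) → j < 2 * suc (suc n') → lev i + Column.foot j + 3 ≤ β + 3 * q + suc r' + 2
  level≤ i j _ _ = ≤-trans (+-monoˡ-≤ 3 (+-mono-≤ lev≤ (Column.foot≤q j))) (≤-reflexive (shuffle (β + 3 * q) r'))
    where
    lev≤ : lev i ≤ β + 3 * q
    lev≤ with lev-bounds i
    ... | inj₁ e = ≤-trans (≤-reflexive e) (≤-trans 1≤β (m≤m+n β _))
    ... | inj₂ (_ , ≤top) = ≤top
    shuffle : ∀ B r' → B + r' + 3 ≡ B + suc r' + 2
    shuffle = solve-∀
  1<2m : 1 < 2 * suc (suc k)
  1<2m = s≤s (s≤s z≤n)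
  2·2+ : ∀ k → 2 * suc (suc k) ≡ suc (suc (suc (suc k))) + k
  2·2+ = solve-∀
  summit<2m : suc (suc q) < 2 * suc (suc k)
  summit<2m = ≤-trans (s≤s (s≤s (s≤s q≤1+k))) (≤-trans (m≤m+n _ k) (≤-reflexive (sym (2·2+ k))))
  r<2n : suc r' < 2 * suc (suc n')
  r<2n = ≤-trans (s≤s r≤n) (≤-trans (n≤1+n _) (≤-trans (m≤m+n _ n') (≤-reflexive (sym (2·2+ n')))))
  top : lev (suc (suc q)) + Column.foot (suc r') + 3 ≡ β + 3 * q + suc r' + 2
  top = trans (cong₂ (λ a b → a + b + 3) lev-summit Column.foot-peak) (shuffle β q r')
    where
    shuffle : ∀ β q r' → β + 3 * q + r' + 3 ≡ β + 3 * q + suc r' + 2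
    shuffle = solve-∀

window-1234 : Window 1 1 (1 + 1) 3 (3 + 1)
window-1234 = window offsets0123 refl refl refl refl

window-3412 : Window 1 3 (3 + 1) 1 (1 + 1)
window-3412 = window offsets2301 refl refl refl refl

-- Up to 3m + 3 write t = 4 + 3q + s with s < 3: a stair of height q + 1 ≤ m with
-- (β, r) = (1, 1), (1, 2) or (3, 1) according to s.
short-stair-cert : ∀ k n' t → 4 ≤ t → t ≤ 3 * suc (suc k) + 3 → LevelCert (2 * suc (suc k)) (2 * suc (suc n')) t
short-stair-cert k n' t 4≤t t≤3m+3 =
  by-residue (x % 3) (m%n<n x 3) (trans (sym (m+[n∸m]≡n 4≤t)) (cong (4 +_) (m≡m%n+[m/n]*n x 3)))
  where
  x q : ℕ
  x = t ∸ 4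
  q = x / 3
  q≤1+k : q ≤ suc k
  q≤1+k = ≤-pred (m<n*o⇒m/o<n (≤-trans (s≤s (∸-monoˡ-≤ 4 t≤3m+3)) (≤-reflexive (bound k))))
    where
    bound : ∀ k → suc (3 * suc (suc k) + 3 ∸ 4) ≡ suc (suc k) * 3
    bound k = trans (cong (λ z → suc (z ∸ 4)) (expand k)) (trans (cong suc (m+n∸m≡n 4 (3 * k + 5))) (collect k))
      where
      expand : ∀ k → 3 * suc (suc k) + 3 ≡ 4 + (3 * k + 5)
      expand = solve-∀
      collect : ∀ k → suc (3 * k + 5) ≡ suc (suc k) * 3
      collect = solve-∀
  by-residue : ∀ s → s < 3 → t ≡ 4 + (s + q * 3) → LevelCert (2 * suc (suc k)) (2 * suc (suc n')) t
  by-residue 0 _ t≡ = subst (LevelCert _ _) (sym (trans t≡ (shape q)))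
                        (stair-cert k q n' 0 1 3 q≤1+k (s≤s z≤n) ≤-refl window-1234)
    where
    shape : ∀ q → 4 + (0 + q * 3) ≡ 1 + 3 * q + 1 + 2
    shape = solve-∀
  by-residue 1 _ t≡ = subst (LevelCert _ _) (sym (trans t≡ (shape q)))
                        (stair-cert k q n' 1 1 3 q≤1+k (s≤s (s≤s z≤n)) ≤-refl window-1234)
    where
    shape : ∀ q → 4 + (1 + q * 3) ≡ 1 + 3 * q + 2 + 2
    shape = solve-∀
  by-residue 2 _ t≡ = subst (LevelCert _ _) (sym (trans t≡ (shape q)))
                        (stair-cert k q n' 0 3 1 q≤1+k (s≤s z≤n) (s≤s z≤n) window-3412)
    where
    shape : ∀ q → 4 + (2 + q * 3) ≡ 3 + 3 * q + 1 + 2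
    shape = solve-∀
  by-residue (suc (suc (suc _))) (s≤s (s≤s (s≤s ()))) _

-- Beyond 3m + 3: the full stair (height m, β = 3) with column height t - 3m - 2 ≤ n.
full-stair-cert : ∀ k n' t → 3 * suc (suc k) + 3 < t → t ≤ 3 * suc (suc k) + suc (suc n') + 2 →
                  LevelCert (2 * suc (suc k)) (2 * suc (suc n')) t
full-stair-cert k n' t 3m+3<t t≤ = subst (LevelCert _ _) (sym t≡) (stair-cert k (suc k) n' r' 3 1 ≤-refl r≤n (s≤s z≤n) window-3412)
  where
  M r' : ℕ
  M  = 3 * suc (suc k) + 3
  r' = t ∸ M
  t≡ : t ≡ 3 + 3 * suc k + suc r' + 2
  t≡ = trans (sym (m+[n∸m]≡n (<⇒≤ 3m+3<t))) (shape k r')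
    where
    shape : ∀ k r' → 3 * suc (suc k) + 3 + r' ≡ 3 + 3 * suc k + suc r' + 2
    shape = solve-∀
  r≤n : suc r' ≤ suc (suc n')
  r≤n = s≤s (≤-trans (∸-monoˡ-≤ M t≤) (≤-reflexive (trans (cong (_∸ M) (shape k n')) (m+n∸m≡n M (suc n')))))
    where
    shape : ∀ k n' → 3 * suc (suc k) + suc (suc n') + 2 ≡ 3 * suc (suc k) + 3 + suc n'
    shape = solve-∀

even-torus-cert : ∀ m n → 2 ≤ m → 2 ≤ n → ∀ t → 4 ≤ t → t ≤ 3 * m + n + 2 → LevelCert (2 * m) (2 * n) t
even-torus-cert (suc (suc k)) (suc (suc n')) _ _ t 4≤t t≤ with t ≤? 3 * suc (suc k) + 3
... | yes t≤3m+3 = short-stair-cert k n' t 4≤t t≤3m+3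
... | no t≰3m+3  = full-stair-cert k n' t (≰⇒> t≰3m+3) t≤
even-torus-cert (suc (suc _)) (suc zero) _ (s≤s ()) _ _ _
even-torus-cert (suc zero) _ (s≤s ()) _ _ _ _

-- Part B.  Rows are pulled back from strips on a path.  The strip values follow
-- the pattern a, b, a + 4, b + 4, a + 8, … (added to a base β).
period4 : ℕ → ℕ → ℕ → ℕ
period4 a b zero          = a
period4 a b (suc zero)    = b
period4 a b (suc (suc j)) = 4 + period4 a b j

data Strip : Set where
  wide lower upper : Strip

spread : Strip → ℕ
spread wide  = 2
spread lower = 1
spread upper = 1

strip-edge : Strip → ℕ → ℕ → ℕ
strip-edge wide  β j = β + period4 2 4 j
strip-edge lower β j = β + period4 0 3 j
strip-edge upper β j = β + period4 3 4 j

strip-vert : ℕ → ℕ → ℕ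
strip-vert β j = β + period4 1 1 j

rise : ℕ → ℕ
rise = period4 1 4

strip-lev : Strip → ℕ → ℕ → ℕ
strip-lev lower β j = β + period4 0 3 j
strip-lev _     β j = β + rise j

regroup : ∀ β {n a b} → n ≡ a + b → β + n ≡ β + a + b
regroup β {a = a} {b} e = trans (cong (β +_) e) (sym (+-assoc β a b))

plus4 : ∀ β z → β + (4 + z) ≡ β + z + 4
plus4 β z = trans (cong (β +_) (+-comm 4 z)) (sym (+-assoc β z 4))

-- Around every path vertex j + 1 the strip has a window: checked for j = 0, 1,
-- and the pattern repeats with all colours raised by 4.
strip-window : ∀ S β j → Window (strip-lev S β j) (strip-edge S β j) (strip-edge S β (suc j))
                                (strip-vert β (suc j)) (strip-vert β (suc j) + spread S)
strip-window wide β 0 = window offsets1302 (regroup β refl) (regroup β refl) (regroup β refl) refl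
strip-window wide β 1 = window offsets0213 (regroup β refl) (regroup β refl) (regroup β refl) (trans (+-assoc β 5 2) (regroup β refl))
strip-window lower β 0 = window offsets0312 (regroup β refl) (regroup β refl) (regroup β refl) (trans (+-assoc β 1 1) (regroup β refl))
strip-window lower β 1 = window offsets0123 (regroup β refl) (regroup β refl) (regroup β refl) (trans (+-assoc β 5 1) (regroup β refl))
strip-window upper β 0 = window offsets2301 (regroup β refl) (regroup β refl) (regroup β refl) (trans (+-assoc β 1 1) (regroup β refl))
strip-window upper β 1 = window offsets0312 (regroup β refl) (regroup β refl) (regroup β refl) (trans (+-assoc β 5 1) (regroup β refl))
strip-window S β (suc (suc j)) =
  window-resp (lev+4 S) (edge+4 S j) (edge+4 S (suc j)) (plus4 β _) (trans (cong (_+ spread S) (plus4 β _)) (+-swapʳ _ 4 (spread S)))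
              (window-shift 4 (strip-window S β j))
  where
  edge+4 : ∀ S j → strip-edge S β (suc (suc j)) ≡ strip-edge S β j + 4
  edge+4 wide  j = plus4 β _
  edge+4 lower j = plus4 β _
  edge+4 upper j = plus4 β _
  lev+4 : ∀ S → strip-lev S β (suc (suc j)) ≡ strip-lev S β j + 4
  lev+4 wide  = plus4 β _
  lev+4 lower = plus4 β _
  lev+4 upper = plus4 β _

rise-closed : ∀ j → rise j ≡ 2 * j + 1 + parity j
rise-closed zero          = refl
rise-closed (suc zero)    = refl
rise-closed (suc (suc j)) = trans (cong (4 +_) (rise-closed j)) (shape j (parity j))
  where
  shape : ∀ j o → 4 + (2 * j + 1 + o) ≡ 2 * suc (suc j) + 1 + o
  shape = solve-∀

rise-step : ∀ j → rise j ≤ rise (suc j) × rise (suc j) ≤ rise j + 3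
rise-step zero          = s≤s z≤n , ≤-refl
rise-step (suc zero)    = s≤s (s≤s (s≤s (s≤s z≤n))) , s≤s (s≤s (s≤s (s≤s (s≤s z≤n))))
rise-step (suc (suc j)) =
  let (rises , step) = rise-step j in +-monoʳ-≤ 4 rises , ≤-trans (+-monoʳ-≤ 4 step) (≤-reflexive (sym (+-assoc 4 (rise j) 3)))

rise-mono : ∀ {j q} → j ≤ q → rise j ≤ rise q
rise-mono {j} {q} j≤q with m≤n⇒m<n∨m≡n j≤q
... | inj₂ refl = ≤-refl
rise-mono {j} {suc q} j≤q | inj₁ j<1+q = ≤-trans (rise-mono (≤-pred j<1+q)) (proj₁ (rise-step q))

lower-below : ∀ j → suc (period4 0 3 j) ≡ rise j
lower-below zero          = refl
lower-below (suc zero)    = refl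
lower-below (suc (suc j)) = trans (+-suc 4 _) (cong (4 +_) (lower-below j))

lower-lev< : ∀ β {j q} → j ≤ q → suc (strip-lev lower β j) ≤ β + rise q
lower-lev< β {j} {q} j≤q = begin
  suc (β + period4 0 3 j) ≡⟨ sym (+-suc β _) ⟩
  β + suc (period4 0 3 j) ≡⟨ cong (β +_) (lower-below j) ⟩
  β + rise j              ≤⟨ +-monoʳ-≤ β (rise-mono j≤q) ⟩
  β + rise q              ∎
  where open ≤-Reasoning

strip-lev≤ : ∀ S β {j q} → j ≤ q → strip-lev S β j ≤ β + rise q
strip-lev≤ wide  β j≤q = +-monoʳ-≤ β (rise-mono j≤q)
strip-lev≤ upper β j≤q = +-monoʳ-≤ β (rise-mono j≤q)
strip-lev≤ lower β j≤q = ≤-trans (n≤1+n _) (lower-lev< β j≤q)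

β≤strip-lev : ∀ S β j → β ≤ strip-lev S β j
β≤strip-lev wide  β j = m≤m+n β _
β≤strip-lev lower β j = m≤m+n β _
β≤strip-lev upper β j = m≤m+n β _

rise≥1 : ∀ j → 1 ≤ rise j
rise≥1 j = rise-mono {0} {j} z≤n

-- rise j ≥ 1, so wide and upper strips stay strictly above their base.
β<strip-lev : ∀ S β j → ¬ S ≡ lower → suc β ≤ strip-lev S β j
β<strip-lev wide  β j _ = ≤-trans (≤-reflexive (+-comm 1 β)) (+-monoʳ-≤ β (rise≥1 j))
β<strip-lev upper β j _ = ≤-trans (≤-reflexive (+-comm 1 β)) (+-monoʳ-≤ β (rise≥1 j))
β<strip-lev lower β j S≢lower = ⊥-elim (S≢lower refl)

extra : Strip → ℕ
extra upper = 1
extra _     = 0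

module StripRow (k q β : ℕ) where
  open Fold k q public

  row-edge : Strip → ℕ → ℕ
  row-edge S = strip-edge S β ∘ fold

  row-vert : ℕ → ℕ
  row-vert = strip-vert β ∘ apex

  row-lev : Strip → ℕ → ℕ
  row-lev S = strip-lev S β ∘ foot

  row-window : p ≤ m → ∀ S x → Window (row-lev S x) (row-edge S (cpred (2 * m) x)) (row-edge S x) (row-vert x) (row-vert x + spread S)
  row-window p≤m S = pullback (strip-edge S β) (strip-vert β) (strip-lev S β) (spread S) (strip-window S β) refl p≤m

  row-lev≤ : ∀ S x → row-lev S x ≤ β + rise q
  row-lev≤ S x = strip-lev≤ S β (foot≤q x)

  row-lev-peak : ∀ S → row-lev S p ≡ strip-lev S β q
  row-lev-peak S = cong (strip-lev S β) foot-peak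

  p<2m : q ≤ suc k → p < 2 * m
  p<2m q≤1+k = ≤-trans (s≤s (s≤s q≤1+k)) (≤-trans (n≤1+n _) (≤-trans (m≤m+n _ k) (≤-reflexive (double k))))
    where
    double : ∀ k → suc (suc (suc (suc k))) + k ≡ 2 * suc (suc k)
    double = solve-∀

  row-lev≥1 : ∀ S → ¬ S ≡ lower ⊎ 1 ≤ β → ∀ x → 1 ≤ row-lev S x
  row-lev≥1 S (inj₁ S≢lower) x = ≤-trans (s≤s z≤n) (β<strip-lev S β (foot x) S≢lower)
  row-lev≥1 S (inj₂ 1≤β)     x = ≤-trans 1≤β (β≤strip-lev S β (foot x))

  narrow-top : ∀ S → spread S ≡ 1 → ∀ x d → row-lev S x + suc d ≤ β + rise q + d + extra S
  narrow-top lower _ x d = ≤-trans (≤-reflexive (+-suc (row-lev lower x) d))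
                             (≤-trans (+-monoˡ-≤ d (lower-lev< β (foot≤q x))) (≤-reflexive (sym (+-identityʳ _))))
  narrow-top upper _ x d = ≤-trans (+-monoˡ-≤ (suc d) (row-lev≤ upper x))
                             (≤-reflexive (trans (+-suc (β + rise q) d) (+-comm 1 (β + rise q + d))))

-- The column profile D₀ on C_{2n+1}, n = n' + 1: it alternates 0, 1, 0, 1, …, 1 and
-- ends with 2 at position 2n.  Row 0 (from 2 down to 0) is wide, rows 1 … 2n-1
-- use the strip c₁ and row 2n (from 1 up to 2) the strip c₂, lifted by 1.
module ZeroColumn (n' : ℕ) (c₁ c₂ : Strip) where
  n N2 : ℕ
  n  = suc n'
  N2 = 2 * n

  profile : ℕ → ℕ
  profile j with j ≟ N2
  ... | yes _ = 2
  ... | no _  = parity j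

  data Row : ℕ → Set where
    bottom : Row 0
    middle : ∀ j → suc j < N2 → Row (suc j)
    last   : ∀ j → suc j ≡ N2 → Row (suc j)
    beyond : ∀ j → N2 < suc j → Row (suc j)

  row : ∀ j → Row j
  row zero = bottom
  row (suc j) with suc j <? N2
  ... | yes h = middle j h
  ... | no h with suc j ≟ N2
  ...   | yes e = last j e
  ...   | no e = beyond j (≤∧≢⇒< (≮⇒≥ h) (λ x → e (sym x)))

  strip-of : ∀ {j} → Row j → Strip
  strip-of bottom         = wide
  strip-of (middle _ _)   = c₁
  strip-of (last _ _)     = c₂
  strip-of (beyond _ _)   = wide

  lift-of : ∀ {j} → Row j → ℕ
  lift-of (last _ _) = 1
  lift-of _          = 0

  strip : ℕ → Strip
  strip j = strip-of (row j)

  lift : ℕ → ℕ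
  lift j = lift-of (row j)

  profile-top : profile N2 ≡ 2
  profile-top with N2 ≟ N2
  ... | yes _ = refl
  ... | no ¬e = ⊥-elim (¬e refl)

  profile-below : ∀ j → j < N2 → profile j ≡ parity j
  profile-below j j<N2 with j ≟ N2
  ... | yes e = ⊥-elim (<-irrefl e j<N2)
  ... | no _  = refl

  column-step : spread c₁ ≡ 1 → spread c₂ ≡ 1 → ∀ j → j < 2 * n + 1 →
                StepBy (spread (strip j)) (lift j) (profile (cpred (2 * n + 1) j)) (profile j)
  column-step s₁ s₂ j j< with row j
  ... | bottom = inj₂ (trans (cong profile (m+n∸n≡m (2 * n) 1)) profile-top , profile-below 0 (s≤s z≤n))
  ... | middle i h with parity-step i
  ...   | inj₁ (p₀ , p₁) = inj₁ (trans (profile-below i (<-trans (n<1+n i) h)) p₀ , trans (profile-below (suc i) h) (trans p₁ (sym s₁)))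
  ...   | inj₂ (p₁ , p₀) = inj₂ (trans (profile-below i (<-trans (n<1+n i) h)) (trans p₁ (sym s₁)) , trans (profile-below (suc i) h) p₀)
  column-step s₁ s₂ j j< | last i e =
    inj₁ (trans (profile-below i (subst (i <_) e (n<1+n i))) odd , trans (cong profile e) (trans profile-top (cong (1 +_) (sym s₂))))
    where
    odd : parity i ≡ 1
    odd = trans (cong parity (suc-injective (trans e (cong suc (trans (+-suc n' (n' + 0)) (cong (λ z → suc (n' + z)) (+-identityʳ n'))))))) (parity-odd n')
  column-step s₁ s₂ j j< | beyond i h = ⊥-elim (<-irrefl refl (<-≤-trans h (≤-pred (subst (suc i <_) (+-comm (2 * n) 1) j<))))

  lift-middle : ∀ j → suc j < N2 → lift (suc j) ≡ 0
  lift-middle j h with suc j <? N2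
  ... | yes _ = refl
  ... | no ¬h = ⊥-elim (¬h h)

  strip-middle : ∀ j → suc j < N2 → strip (suc j) ≡ c₁
  strip-middle j h with suc j <? N2
  ... | yes _ = refl
  ... | no ¬h = ⊥-elim (¬h h)

  lift-last : lift N2 ≡ 1
  lift-last with N2 <? N2
  ... | yes h = ⊥-elim (<-irrefl refl h)
  ... | no _ with N2 ≟ N2
  ...   | yes _ = refl
  ...   | no ¬e = ⊥-elim (¬e refl)

  strip-last : strip N2 ≡ c₂
  strip-last with N2 <? N2
  ... | yes h = ⊥-elim (<-irrefl refl h)
  ... | no _ with N2 ≟ N2
  ...   | yes _ = refl
  ...   | no ¬e = ⊥-elim (¬e refl)

-- The column profile D_s on C_{2n+1}, for 2 ≤ s = s' + 1 ≤ n = n' + 1: it climbs by 2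
-- to 2s, descends by 2 through the odd values 2s - 1, …, 1 and then oscillates
-- between 1 and 3.  Row 0 (from 1 down to 0) uses the strip c₁, row s + 1 (from 2s
-- down to 2s - 1) the strip c₂, and all other rows are wide.
module SlopeColumn (n' s' : ℕ) (c₁ c₂ : Strip) where
  n s S2 F : ℕ
  n  = suc n'
  s  = suc s'
  S2 = 2 * s
  F  = 4 * s + 1

  s<S2 : s < S2
  s<S2 = subst (s <_) (sym (+-suc s (s' + 0))) (s≤s (m≤m+n s _))

  profile : ℕ → ℕ
  profile = piecewise s S2 (2 *_) (λ j → F ∸ 2 * j) (λ j → 1 + 2 * parity (j ∸ S2))

  profile-up : ∀ j → j ≤ s → profile j ≡ 2 * j
  profile-up j = piece₁

  profile-down : ∀ j → s < j → j ≤ S2 → profile j ≡ F ∸ 2 * j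
  profile-down j = piece₂

  profile-swing : ∀ j → S2 < j → profile j ≡ 1 + 2 * parity (j ∸ S2)
  profile-swing j = piece₃ (<⇒≤ s<S2)

  data Row : ℕ → Set where
    start   : Row 0
    climb   : ∀ j → suc j ≤ s → Row (suc j)
    crest   : ∀ j → j ≡ s → Row (suc j)
    descend : ∀ j → suc s < suc j → suc j ≤ S2 → Row (suc j)
    swing   : ∀ j → S2 < suc j → Row (suc j)

  row : ∀ j → Row j
  row zero = start
  row (suc j) with suc j ≤? s
  ... | yes h = climb j h
  ... | no h with j ≟ s
  ...   | yes e = crest j e
  ...   | no e with suc j ≤? S2
  ...     | yes h' = descend j (s≤s (≤∧≢⇒< (≤-pred (≰⇒> h)) (λ x → e (sym x)))) h'
  ...     | no h' = swing j (≰⇒> h')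

  strip-of : ∀ {j} → Row j → Strip
  strip-of start           = c₁
  strip-of (climb _ _)     = wide
  strip-of (crest _ _)     = c₂
  strip-of (descend _ _ _) = wide
  strip-of (swing _ _)     = wide

  lift-of : ∀ {j} → Row j → ℕ
  lift-of start           = 0
  lift-of (climb j _)     = 2 * j
  lift-of (crest j _)     = F ∸ 2 * suc j
  lift-of (descend j _ _) = F ∸ 2 * suc j
  lift-of (swing _ _)     = 1

  strip : ℕ → Strip
  strip j = strip-of (row j)

  lift : ℕ → ℕ
  lift j = lift-of (row j)

  F∸2S2 : F ∸ 2 * S2 ≡ 1
  F∸2S2 = trans (cong (_∸ 2 * S2) (shape s)) (m+n∸m≡n (2 * S2) 1)
    where
    shape : ∀ s → 4 * s + 1 ≡ 2 * (2 * s) + 1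
    shape = solve-∀

  F∸crest : F ∸ 2 * suc s ≡ suc (2 * s')
  F∸crest = trans (cong (_∸ 2 * suc s) (shape s')) (m+n∸m≡n (2 * suc s) (suc (2 * s')))
    where
    shape : ∀ s' → 4 * suc s' + 1 ≡ 2 * suc (suc s') + suc (2 * s')
    shape = solve-∀

  ∸2-step : ∀ N x → 2 * suc x ≤ N → N ∸ 2 * x ≡ (N ∸ 2 * suc x) + 2
  ∸2-step N x h = trans (cong (_∸ 2 * x) (trans (sym (m∸n+n≡m h)) (shape (N ∸ 2 * suc x) x))) (m+n∸n≡m (N ∸ 2 * suc x + 2) (2 * x))
    where
    shape : ∀ A x → A + 2 * suc x ≡ A + 2 + 2 * x
    shape = solve-∀

  -- The profile ends at 1 on position 2n: at the foot of the descent when s = n,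
  -- and after an even number of oscillation steps otherwise.
  profile-last : s ≤ n → profile (2 * n) ≡ 1
  profile-last s≤n with n ≤? s
  ... | yes n≤s = trans (profile-down (2 * n) (subst (_< 2 * n) (sym s≡n) (subst (n <_) (sym (+-suc n (n' + 0))) (s≤s (m≤m+n n _))))
                                      (*-monoʳ-≤ 2 n≤s))
                        (subst (λ z → F ∸ 2 * (2 * z) ≡ 1) s≡n F∸2S2)
    where
    s≡n : s ≡ n
    s≡n = ≤-antisym s≤n n≤s
  ... | no n≰s = trans (profile-swing (2 * n) (*-monoʳ-< 2 (≤∧≢⇒< s≤n (λ e → n≰s (≤-reflexive (sym e))))))
                       (cong (λ z → 1 + 2 * z) (trans (cong parity (sym (*-distribˡ-∸ 2 n s))) (parity-double (n ∸ s))))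

  column-step : spread c₁ ≡ 1 → spread c₂ ≡ 1 → s ≤ n → ∀ j → j < 2 * n + 1 →
                StepBy (spread (strip j)) (lift j) (profile (cpred (2 * n + 1) j)) (profile j)
  column-step s₁ s₂ s≤n j j< with row j
  ... | start = inj₂ (trans (cong profile (m+n∸n≡m (2 * n) 1)) (trans (profile-last s≤n) (sym s₁)) , profile-up 0 z≤n)
  ... | climb i h = inj₁ (profile-up i (≤-trans (n≤1+n i) h) , trans (profile-up (suc i) h) (two-more i))
    where
    two-more : ∀ i → 2 * suc i ≡ 2 * i + 2
    two-more = solve-∀
  ... | crest i refl = inj₂ (trans (profile-up s ≤-refl) (trans (twice s') (trans (cong (_+ 1) (sym F∸crest)) (cong (F ∸ 2 * suc s +_) (sym s₂)))) ,
                             profile-down (suc s) (n<1+n s) s<S2)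
    where
    twice : ∀ s' → 2 * suc s' ≡ suc (2 * s') + 1
    twice = solve-∀
  ... | descend i h₁ h₂ = inj₂ (trans (profile-down i (≤-pred h₁) (≤-trans (n≤1+n _) h₂)) (∸2-step F i (≤-trans (*-monoʳ-≤ 2 h₂) (≤-trans (≤-reflexive (double s)) (m≤m+n _ 1)))) ,
                                profile-down (suc i) (<-trans (n<1+n s) h₁) h₂)
    where
    double : ∀ s → 2 * (2 * s) ≡ 4 * s
    double = solve-∀
  ... | swing i h with m≤n⇒m<n∨m≡n (≤-pred h)
  ...   | inj₂ refl = inj₁ (trans (profile-down S2 s<S2 ≤-refl) F∸2S2 ,
                            trans (profile-swing (suc S2) h) (cong (λ z → 1 + 2 * parity z) (m+n∸n≡m 1 S2)))
  ...   | inj₁ S2<i with parity-stepBy S2 i (<⇒≤ S2<i)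
  ...     | inj₁ (p₀ , p₁) = inj₁ (trans (profile-swing i S2<i) (cong (λ z → 1 + 2 * z) p₀) ,
                                   trans (profile-swing (suc i) h) (cong (λ z → 1 + 2 * z) p₁))
  ...     | inj₂ (p₁ , p₀) = inj₂ (trans (profile-swing i S2<i) (cong (λ z → 1 + 2 * z) p₁) ,
                                   trans (profile-swing (suc i) h) (cong (λ z → 1 + 2 * z) p₀))

  lift-first : lift 1 ≡ 0
  lift-first with 1 ≤? s
  ... | yes _ = refl
  ... | no ¬h = ⊥-elim (¬h (s≤s z≤n))

  strip-first : strip 1 ≡ wide
  strip-first with 1 ≤? s
  ... | yes _ = refl
  ... | no ¬h = ⊥-elim (¬h (s≤s z≤n))

  lift-top : lift s ≡ 2 * s'
  lift-top with s ≤? s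
  ... | yes _ = refl
  ... | no ¬h = ⊥-elim (¬h ≤-refl)

  strip-top : strip s ≡ wide
  strip-top with s ≤? s
  ... | yes _ = refl
  ... | no ¬h = ⊥-elim (¬h ≤-refl)

  lift-crest : lift (suc s) ≡ suc (2 * s')
  lift-crest with suc s ≤? s
  ... | yes h = ⊥-elim (<-irrefl refl h)
  ... | no _ with s ≟ s
  ...   | yes _ = F∸crest
  ...   | no ¬e = ⊥-elim (¬e refl)

  strip-crest : strip (suc s) ≡ c₂
  strip-crest with suc s ≤? s
  ... | yes h = ⊥-elim (<-irrefl refl h)
  ... | no _ with s ≟ s
  ...   | yes _ = refl
  ...   | no ¬e = ⊥-elim (¬e refl)

module ZeroCert (k q n' β : ℕ) (c₁ c₂ : Strip) (q≤1+k : q ≤ suc k)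
                (spread₁ : spread c₁ ≡ 1) (spread₂ : spread c₂ ≡ 1) (grounded : ¬ c₁ ≡ lower ⊎ 1 ≤ β) where
  open StripRow k q β public
  open ZeroColumn n' c₁ c₂ public

  t : ℕ
  t = β + rise q + 3 + extra c₂

  rows : RowData (2 * m) (2 * n + 1)
  rows = record { D = profile ; d = lift ; δ = spread ∘ strip ; R = row-edge ∘ strip ; C = row-vert
                ; ℓ = row-lev ∘ strip ; column-steps = column-step spread₁ spread₂
                ; row-windows = λ j i _ _ → row-window (s≤s q≤1+k) (strip j) i }

  level≥1 : ∀ i j → i < 2 * m → j < 2 * n + 1 → 1 ≤ row-lev (strip j) i + lift j
  level≥1 i j _ _ with row j
  ... | bottom     = ≤-trans (row-lev≥1 wide (inj₁ λ ()) i) (m≤m+n _ 0)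
  ... | middle _ _ = ≤-trans (row-lev≥1 c₁ grounded i) (m≤m+n _ 0)
  ... | last _ _   = m≤n+m 1 _
  ... | beyond _ _ = ≤-trans (row-lev≥1 wide (inj₁ λ ()) i) (m≤m+n _ 0)

  unlifted : ∀ S i → row-lev S i + 0 + 3 ≤ t
  unlifted S i = ≤-trans (+-monoˡ-≤ 3 (≤-trans (≤-reflexive (+-identityʳ _)) (row-lev≤ S i))) (m≤m+n _ _)

  level≤ : ∀ i j → i < 2 * m → j < 2 * n + 1 → row-lev (strip j) i + lift j + 3 ≤ t
  level≤ i j _ _ with row j
  ... | bottom     = unlifted wide i
  ... | middle _ _ = unlifted c₁ i
  ... | last _ _   = ≤-trans (≤-reflexive (+-assoc _ 1 3)) (narrow-top c₂ spread₂ i 3)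
  ... | beyond _ _ = unlifted wide i

  cert : (i₀ j₀ i₁ j₁ : ℕ) → i₀ < 2 * m → j₀ < 2 * n + 1 → i₁ < 2 * m → j₁ < 2 * n + 1 →
         row-lev (strip j₀) i₀ + lift j₀ ≡ 1 → row-lev (strip j₁) i₁ + lift j₁ + 3 ≡ t → LevelCert (2 * m) (2 * n + 1) t
  cert = RowCert.cert rows level≥1 level≤

  1<N2 : 1 < N2
  1<N2 = *-monoʳ-≤ 2 (s≤s (z≤n {n'}))

  1<2n+1 : 1 < 2 * n + 1
  1<2n+1 = ≤-trans 1<N2 (m≤m+n _ 1)

module SlopeCert (k q n' s' β : ℕ) (c₁ c₂ : Strip) (q≤1+k : q ≤ suc k) (s≤n : suc s' ≤ suc n') (1≤s' : 1 ≤ s')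
                 (spread₁ : spread c₁ ≡ 1) (spread₂ : spread c₂ ≡ 1) (grounded : ¬ c₁ ≡ lower ⊎ 1 ≤ β) where
  open StripRow k q β public
  open SlopeColumn n' s' c₁ c₂ public

  t : ℕ
  t = β + rise q + 2 * s + 1 + extra c₂

  rows : RowData (2 * m) (2 * n + 1)
  rows = record { D = profile ; d = lift ; δ = spread ∘ strip ; R = row-edge ∘ strip ; C = row-vert
                ; ℓ = row-lev ∘ strip ; column-steps = column-step spread₁ spread₂ s≤n
                ; row-windows = λ j i _ _ → row-window (s≤s q≤1+k) (strip j) i }

  level≥1 : ∀ i j → i < 2 * m → j < 2 * n + 1 → 1 ≤ row-lev (strip j) i + lift j
  level≥1 i j _ _ with row j
  ... | start         = ≤-trans (row-lev≥1 c₁ grounded i) (m≤m+n _ 0)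
  ... | climb _ _     = ≤-trans (row-lev≥1 wide (inj₁ λ ()) i) (m≤m+n _ _)
  ... | crest _ refl  = subst (λ z → 1 ≤ row-lev c₂ i + z) (sym F∸crest) (≤-trans (s≤s z≤n) (m≤n+m (suc (2 * s')) (row-lev c₂ i)))
  ... | descend _ _ _ = ≤-trans (row-lev≥1 wide (inj₁ λ ()) i) (m≤m+n _ _)
  ... | swing _ _     = ≤-trans (row-lev≥1 wide (inj₁ λ ()) i) (m≤m+n _ _)

  within : ∀ S i d → d + 3 ≤ 2 * s + 1 → row-lev S i + d + 3 ≤ t
  within S i d d+3≤ = begin
    row-lev S i + d + 3       ≡⟨ +-assoc (row-lev S i) d 3 ⟩
    row-lev S i + (d + 3)     ≤⟨ +-mono-≤ (row-lev≤ S i) d+3≤ ⟩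
    β + rise q + (2 * s + 1)  ≡⟨ sym (+-assoc (β + rise q) (2 * s) 1) ⟩
    β + rise q + 2 * s + 1    ≤⟨ m≤m+n _ (extra c₂) ⟩
    t                         ∎
    where open ≤-Reasoning

  level≤ : ∀ i j → i < 2 * m → j < 2 * n + 1 → row-lev (strip j) i + lift j + 3 ≤ t
  level≤ i j _ _ with row j
  ... | start = within c₁ i 0 (+-monoˡ-≤ 1 (*-monoʳ-≤ 2 (s≤s (z≤n {s'}))))
  ... | climb j j<s = within wide i (2 * j) (≤-trans (≤-reflexive (shape j)) (+-monoˡ-≤ 1 (*-monoʳ-≤ 2 j<s)))
    where
    shape : ∀ j → 2 * j + 3 ≡ 2 * suc j + 1
    shape = solve-∀
  ... | crest _ refl = subst (λ z → row-lev c₂ i + z + 3 ≤ t) (sym F∸crest)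
                         (≤-trans (≤-reflexive (+-assoc (row-lev c₂ i) (suc (2 * s')) 3))
                           (≤-trans (narrow-top c₂ spread₂ i (2 * s' + 3)) (≤-reflexive (cong (_+ extra c₂) (shape (β + rise q) s')))))
    where
    shape : ∀ B s' → B + (2 * s' + 3) ≡ B + 2 * suc s' + 1
    shape = solve-∀
  ... | descend j h₁ _ = within wide i (F ∸ 2 * suc j) (≤-trans (+-monoˡ-≤ 3 below) (≤-reflexive (shape s')))
    where
    below : F ∸ 2 * suc j ≤ 2 * s' + 0
    below = ≤-trans (∸-monoʳ-≤ F (*-monoʳ-≤ 2 h₁)) (m≤n+o⇒m∸n≤o F (2 * suc (suc s)) (≤-trans (n≤1+n F) (≤-reflexive (F+1 s'))))
      where
      F+1 : ∀ s' → suc (4 * suc s' + 1) ≡ 2 * suc (suc (suc s')) + (2 * s' + 0)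
      F+1 = solve-∀
    shape : ∀ s' → 2 * s' + 0 + 3 ≡ 2 * suc s' + 1
    shape = solve-∀
  ... | swing _ _ = within wide i 1 (≤-trans (s≤s (s≤s (s≤s (s≤s z≤n)))) (≤-trans (*-monoʳ-≤ 2 (s≤s 1≤s')) (m≤m+n _ 1)))

  cert : (i₀ j₀ i₁ j₁ : ℕ) → i₀ < 2 * m → j₀ < 2 * n + 1 → i₁ < 2 * m → j₁ < 2 * n + 1 →
         row-lev (strip j₀) i₀ + lift j₀ ≡ 1 → row-lev (strip j₁) i₁ + lift j₁ + 3 ≡ t → LevelCert (2 * m) (2 * n + 1) t
  cert = RowCert.cert rows level≥1 level≤

  s<2n+1 : s < 2 * n + 1
  s<2n+1 = ≤-trans (s≤s s≤n) (≤-trans (≤-reflexive (+-comm 1 n)) (+-monoˡ-≤ 1 (m≤m+n n _)))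

  crest<2n+1 : suc s < 2 * n + 1
  crest<2n+1 = ≤-trans (s≤s (s≤s s≤n)) (≤-trans (m≤m+n _ n') (≤-reflexive (shape n')))
    where
    shape : ∀ n' → suc (suc (suc n')) + n' ≡ 2 * suc n' + 1
    shape = solve-∀

-- The three choices (c₁, c₂, β) = (upper, lower, 0), (lower, lower, 1), (lower, upper, 1)
-- realise t = rise q + 3 + e for e = 0, 1, 2.  With D₀ the lowest level 1
-- is at the start of row 0 or row 1, the top at the peak of row 0 or row 2n.
zero-cert : ∀ k q n' → q ≤ suc k → ∀ e → e ≤ 2 → LevelCert (2 * suc (suc k)) (2 * suc n' + 1) (rise q + 3 + e)
zero-cert k q n' q≤1+k 0 _ =
  Z.cert 0 0 p 0 (s≤s z≤n) (s≤s z≤n) (Z.p<2m q≤1+k) (s≤s z≤n) refl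
         (trans (cong (λ z → z + 0 + 3) (Z.row-lev-peak wide)) (+-swapʳ (rise q) 0 3))
  where
  module Z = ZeroCert k q n' 0 upper lower q≤1+k refl refl (inj₁ λ ())
  open Z using (p)
zero-cert k q n' q≤1+k 1 _ = subst (LevelCert _ _) (shape (rise q))
  (Z.cert 0 1 p 0 (s≤s z≤n) Z.1<2n+1 (Z.p<2m q≤1+k) (s≤s z≤n)
          (cong₂ (λ S d → Z.row-lev S 0 + d) (Z.strip-middle 0 Z.1<N2) (Z.lift-middle 0 Z.1<N2))
          (trans (cong (λ z → z + 0 + 3) (Z.row-lev-peak wide)) (+-swapʳ (1 + rise q) 0 3)))
  where
  module Z = ZeroCert k q n' 1 lower lower q≤1+k refl refl (inj₂ (s≤s z≤n))
  open Z using (p)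
  shape : ∀ r → 1 + r + 3 + 0 ≡ r + 3 + 1
  shape = solve-∀
zero-cert k q n' q≤1+k 2 _ = subst (LevelCert _ _) (shape (rise q))
  (Z.cert 0 1 p (2 * suc n') (s≤s z≤n) Z.1<2n+1 (Z.p<2m q≤1+k) (≤-reflexive (+-comm 1 _))
          (cong₂ (λ S d → Z.row-lev S 0 + d) (Z.strip-middle 0 Z.1<N2) (Z.lift-middle 0 Z.1<N2))
          (trans (cong₂ (λ S d → Z.row-lev S p + d + 3) Z.strip-last Z.lift-last)
                 (trans (cong (λ z → z + 1 + 3) (Z.row-lev-peak upper)) (+-swapʳ (1 + rise q) 1 3))))
  where
  module Z = ZeroCert k q n' 1 lower upper q≤1+k refl refl (inj₂ (s≤s z≤n))
  open Z using (p)
  shape : ∀ r → 1 + r + 3 + 1 ≡ r + 3 + 2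
  shape = solve-∀
zero-cert k q n' q≤1+k (suc (suc (suc _))) (s≤s (s≤s ()))

slope-cert : ∀ k q n' s' → q ≤ suc k → suc s' ≤ suc n' → 1 ≤ s' → ∀ e → e ≤ 2 →
             LevelCert (2 * suc (suc k)) (2 * suc n' + 1) (rise q + 2 * suc s' + 1 + e)
slope-cert k q n' s' q≤1+k s≤n 1≤s' 0 _ =
  S.cert 0 1 p (suc s') (s≤s z≤n) (≤-trans (s≤s (s≤s z≤n)) S.s<2n+1) (S.p<2m q≤1+k) S.s<2n+1
         (cong₂ (λ S d → S.row-lev S 0 + d) S.strip-first S.lift-first)
         (trans (cong₂ (λ S d → S.row-lev S p + d + 3) S.strip-top S.lift-top)
                (trans (cong (λ z → z + 2 * s' + 3) (S.row-lev-peak wide)) (shape (rise q) s')))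
  where
  module S = SlopeCert k q n' s' 0 upper lower q≤1+k s≤n 1≤s' refl refl (inj₁ λ ())
  open S using (p)
  shape : ∀ r s' → r + 2 * s' + 3 ≡ r + 2 * suc s' + 1 + 0
  shape = solve-∀
slope-cert k q n' s' q≤1+k s≤n 1≤s' 1 _ = subst (LevelCert _ _) (reshape (rise q) s')
  (S.cert 0 0 p (suc s') (s≤s z≤n) (s≤s z≤n) (S.p<2m q≤1+k) S.s<2n+1 refl
          (trans (cong₂ (λ S d → S.row-lev S p + d + 3) S.strip-top S.lift-top)
                 (trans (cong (λ z → z + 2 * s' + 3) (S.row-lev-peak wide)) (shape (rise q) s'))))
  where
  module S = SlopeCert k q n' s' 1 lower lower q≤1+k s≤n 1≤s' refl refl (inj₂ (s≤s z≤n))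
  open S using (p)
  shape : ∀ r s' → 1 + r + 2 * s' + 3 ≡ 1 + r + 2 * suc s' + 1 + 0
  shape = solve-∀
  reshape : ∀ r s' → 1 + r + 2 * suc s' + 1 + 0 ≡ r + 2 * suc s' + 1 + 1
  reshape = solve-∀
slope-cert k q n' s' q≤1+k s≤n 1≤s' 2 _ = subst (LevelCert _ _) (reshape (rise q) s')
  (S.cert 0 0 p (suc (suc s')) (s≤s z≤n) (s≤s z≤n) (S.p<2m q≤1+k) S.crest<2n+1 refl
          (trans (cong₂ (λ S d → S.row-lev S p + d + 3) S.strip-crest S.lift-crest)
                 (trans (cong (λ z → z + suc (2 * s') + 3) (S.row-lev-peak upper)) (shape (rise q) s'))))
  where
  module S = SlopeCert k q n' s' 1 lower upper q≤1+k s≤n 1≤s' refl refl (inj₂ (s≤s z≤n))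
  open S using (p)
  shape : ∀ r s' → 1 + r + suc (2 * s') + 3 ≡ 1 + r + 2 * suc s' + 1 + 1
  shape = solve-∀
  reshape : ∀ r s' → 1 + r + 2 * suc s' + 1 + 1 ≡ r + 2 * suc s' + 1 + 2
  reshape = solve-∀
slope-cert k q n' s' q≤1+k s≤n 1≤s' (suc (suc (suc _))) (s≤s (s≤s ()))

cover : (P : ℕ → Set) (a : ℕ → ℕ) (N : ℕ) → (∀ i → i < N → a (suc i) ≤ a i + 3) →
        (∀ i → i ≤ N → ∀ e → e ≤ 2 → P (a i + e)) → ∀ t → a 0 ≤ t → t ≤ a N + 2 → P t
cover P a N advance realise t a₀≤t t≤ with a N ≤? t
... | yes aN≤t = subst P (m+[n∸m]≡n aN≤t) (realise N ≤-refl (t ∸ a N) (m≤n+o⇒m∸n≤o t (a N) t≤))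
cover P a zero    advance realise t a₀≤t t≤ | no aN≰t = ⊥-elim (aN≰t a₀≤t)
cover P a (suc N) advance realise t a₀≤t t≤ | no aN≰t =
  cover P a N (λ i i<N → advance i (≤-trans i<N (n≤1+n N))) (λ i i≤N → realise i (≤-trans i≤N (n≤1+n N))) t a₀≤t
        (≤-pred (≤-trans (≰⇒> aN≰t) (≤-trans (advance N ≤-refl) (≤-reflexive (+-suc (a N) 2)))))

-- Every t in [4, rise (m-1) + 2n + 3] is realised on T(2m, 2n+1): the profile D₀ with
-- stairs of height q + 1 ≤ m covers [4, rise (m-1) + 5], and D_s with full stairs
-- covers [rise (m-1) + 2s + 1, rise (m-1) + 2s + 3] for 2 ≤ s ≤ n.
odd-torus-cert : ∀ k n' t → 4 ≤ t → t ≤ rise (suc k) + 2 * suc n' + 3 →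
                 LevelCert (2 * suc (suc k)) (2 * suc n' + 1) t
odd-torus-cert k n' t 4≤t t≤ with t ≤? rise (suc k) + 3 + 2
... | yes t≤R+5 = cover (LevelCert _ _) (λ q → rise q + 3) (suc k)
                        (λ q _ → +-monoˡ-≤ 3 (proj₂ (rise-step q)))
                        (λ q q≤1+k e e≤2 → zero-cert k q n' q≤1+k e e≤2) t 4≤t t≤R+5
odd-torus-cert k zero t 4≤t t≤ | no t≰R+5 = ⊥-elim (t≰R+5 (≤-trans t≤ (≤-reflexive (shape (rise (suc k))))))
  where
  shape : ∀ R → R + 2 * 1 + 3 ≡ R + 3 + 2
  shape = solve-∀
odd-torus-cert k (suc n') t 4≤t t≤ | no t≰R+5 =
  cover (LevelCert _ _) (λ i → R + 2 * suc (suc i) + 1) n'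
        (λ i _ → ≤-trans (≤-reflexive (two-more R i)) (+-monoʳ-≤ (R + 2 * suc (suc i) + 1) (s≤s (s≤s z≤n))))
        (λ i i≤n' e e≤2 → slope-cert k (suc k) (suc n') (suc i) ≤-refl (s≤s (s≤s i≤n')) (s≤s z≤n) e e≤2)
        t (≤-trans (≤-reflexive (shape R)) (<⇒≤ (≰⇒> t≰R+5))) (≤-trans t≤ (≤-reflexive (shape' R n')))
  where
  R : ℕ
  R = rise (suc k)
  two-more : ∀ R i → R + 2 * suc (suc (suc i)) + 1 ≡ R + 2 * suc (suc i) + 1 + 2
  two-more = solve-∀
  shape : ∀ R → R + 2 * 2 + 1 ≡ R + 3 + 2
  shape = solve-∀
  shape' : ∀ R n' → R + 2 * suc (suc n') + 3 ≡ R + 2 * suc (suc n') + 1 + 2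
  shape' = solve-∀

3≤2* : ∀ {m} → 2 ≤ m → 3 ≤ 2 * m
3≤2* 2≤m = ≤-trans (s≤s (s≤s (s≤s z≤n))) (*-monoʳ-≤ 2 2≤m)

3≤2*+1 : ∀ {n} → 1 ≤ n → 3 ≤ 2 * n + 1
3≤2*+1 1≤n = +-monoˡ-≤ 1 (*-monoʳ-≤ 2 1≤n)

-- The even torus T(2m, 2n): by symmetry we may let the larger bound be 3m + n + 2.
even-torus : ∀ m n → 2 ≤ m → 2 ≤ n → ∀ t → 4 ≤ t → t ≤ (3 * m + n + 2) ⊔ (3 * n + m + 2) →
             HasIntervalColoring (torusAdj (2 * m) (2 * n)) t
even-torus m n 2≤m 2≤n t 4≤t t≤ with ≤-total (3 * m + n + 2) (3 * n + m + 2)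
... | inj₁ le = torus-colouring (3≤2* 2≤m) (3≤2* 2≤n)
                  (transpose-cert (even-torus-cert n m 2≤n 2≤m t 4≤t (subst (t ≤_) (m≤n⇒m⊔n≡n le) t≤)))
... | inj₂ ge = torus-colouring (3≤2* 2≤m) (3≤2* 2≤n) (even-torus-cert m n 2≤m 2≤n t 4≤t (subst (t ≤_) (m≥n⇒m⊔n≡m ge) t≤))

odd-torus : ∀ m n → 2 ≤ m → 1 ≤ n → ∀ t → 4 ≤ t → t ≤ rise (m ∸ 1) + 2 * n + 3 →
            HasIntervalColoring (torusAdj (2 * m) (2 * n + 1)) t
odd-torus (suc (suc k)) (suc n') 2≤m 1≤n t 4≤t t≤ = torus-colouring (3≤2* 2≤m) (3≤2*+1 1≤n) (odd-torus-cert k n' t 4≤t t≤)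
odd-torus (suc zero) _ (s≤s ()) _ _ _ _

odd-reach : ∀ m n → 2 ≤ m → 2 * m + 2 * n + 2 ≤ rise (m ∸ 1) + 2 * n + 3
odd-reach (suc (suc k)) n _ =
  ≤-trans (≤-reflexive (shape k n)) (+-monoˡ-≤ 3 (+-monoˡ-≤ (2 * n) (≤-trans (m≤m+n (2 * suc k + 1) (parity (suc k))) (≤-reflexive (sym (rise-closed (suc k)))))))
  where
  shape : ∀ k n → 2 * suc (suc k) + 2 * n + 2 ≡ 2 * suc k + 1 + 2 * n + 3
  shape = solve-∀
odd-reach (suc zero) _ (s≤s ())

even-reach : ∀ m n → 2 ≤ m → m % 2 ≡ 0 → rise (m ∸ 1) + 2 * n + 3 ≡ 2 * m + 2 * n + 3
even-reach (suc (suc k)) n _ m-even = trans (cong (λ r → r + 2 * n + 3) (trans (rise-closed (suc k)) (cong (2 * suc k + 1 +_) odd-pred))) (shape k n)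
  where
  odd-pred : parity (suc k) ≡ 1
  odd-pred with parity-step k
  ... | inj₁ (_ , p₁) = p₁
  ... | inj₂ (p₁ , _) = ⊥-elim (0≢1+n (trans (sym (trans (sym (parity-%2 (suc (suc k)))) m-even)) p₁))
  shape : ∀ k n → 2 * suc k + 1 + 1 + 2 * n + 3 ≡ 2 * suc (suc k) + 2 * n + 3
  shape = solve-∀
even-reach (suc zero) _ (s≤s ())

corollary5 : (∀ (m n : ℕ) → 2 ≤ m → 2 ≤ n → ∀ (t : ℕ) → 4 ≤ t →
    t ≤ (3 * m + n + 2) ⊔ (3 * n + m + 2) →
    HasIntervalColoring (torusAdj (2 * m) (2 * n)) t)
    ×
    (∀ (m n : ℕ) → 2 ≤ m → 1 ≤ n →
    (m % 2 ≡ 1 → ∀ (t : ℕ) → 4 ≤ t → t ≤ 2 * m + 2 * n + 2 →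
    HasIntervalColoring (torusAdj (2 * m) (2 * n + 1)) t)
    ×
    (m % 2 ≡ 0 → ∀ (t : ℕ) → 4 ≤ t → t ≤ 2 * m + 2 * n + 3 →
    HasIntervalColoring (torusAdj (2 * m) (2 * n + 1)) t))
corollary5 = even-torus , λ m n 2≤m 1≤n →
  (λ _ t 4≤t t≤ → odd-torus m n 2≤m 1≤n t 4≤t (≤-trans t≤ (odd-reach m n 2≤m))) ,
  (λ m-even t 4≤t t≤ → odd-torus m n 2≤m 1≤n t 4≤t (≤-trans t≤ (≤-reflexive (sym (even-reach m n 2≤m m-even)))))
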